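{- If $G_1$ and $G_2$ are cospectral for the $L^{(q)}$ matrix with $S=B_1\oplus \cdots\oplus B_\ell$ as a similarity matrix, then for the similarity vertex partitioning $V_1,\ldots,V_\ell$ the graphs $\displaystyle G_1\circ_{i=1}^\ell{}_{V_i}H_i$ and $\displaystyle G_2\circ_{i=1}^\ell{}_{V_i}H_i$ are cospectral for the $L^{(q)}$ matrix for any choice of $H_1,\ldots,H_\ell$.
   Context: All graphs are simple and undirected. For fixed $q$, the $q$-Laplacian $L^{(q)}_G$ has $(u,v)$ entry $q\deg_G(u)$ if $u=v$, $1$ if $u,v$ adjacent, $0$ otherwise (so $q=0,1,-1$ give the adjacency matrix, signless Laplacian, and negative Laplacian). $G_1$ and $G_2$ have the same vertex set labeling; $S$ is an invertible block diagonal matrix $B_1\oplus\cdots\oplus B_\ell$ with $S L^{(q)}_{G_1}S^{ -1}=L^{(q)}_{G_2}$, and the similarity vertex partitioning $V_1,\ldots,V_\ell$ assigns to $V_i$ the vertices indexing the rows of block $B_i$. Given rooted graphs $H_1,\ldots,H_\ell$, $\displaystyle G\circ_{i=1}^\ell{}_{V_i}H_i$ denotes the graph obtained from the disjoint union of $G$ and, for each $i$ and each $v\in V_i$, a separate copy of $H_i$, by identifying the root of that copy of $H_i$ with $v$. -}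

module Defs where

open import Level using (Level; _⊔_)
open import Data.Nat using (ℕ; zero; suc)
import Data.Nat as ℕ
open import Data.Fin using (Fin; zero; suc; splitAt; punchIn; _≟_)
open import Data.Bool using (Bool; true; false; if_then_else_; _∧_; _∨_)
open import Data.Sum using (inj₁; inj₂)
open import Data.Product using (Σ; _×_; _,_)
open import Data.List using (List; []; _∷_; map)
open import Data.Unit.Polymorphic using (⊤)
open import Function using (_∘_)
open import Relation.Nullary using (yes; no)
open import Relation.Nullary.Decidable using (⌊_⌋)
open import Relation.Binary.PropositionalEquality using (_≡_; refl)
open import Algebra.Bundles using (CommutativeRing)

Graph : ℕ → Set
Graph n = Fin n → Fin n → Bool

IsSimple : ∀ {n} → Graph n → Set
IsSimple {n} G = (∀ (u v : Fin n) → G u v ≡ G v u) × (∀ (v : Fin n) → G v v ≡ false)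

sumℕ : ∀ n → (Fin n → ℕ) → ℕ
sumℕ zero    f = 0
sumℕ (suc n) f = f zero ℕ.+ sumℕ n (f ∘ suc)

deg : ∀ {n} → Graph n → Fin n → ℕ
deg {n} G v = sumℕ n (λ u → if G v u then 1 else 0)

-- The partition V_1..V_ℓ is given by  part : Fin n → Fin ℓ  (V_i = part⁻¹ i).
-- Vertices of the product: pairs (v , a) with v : Fin n and a : Fin (k (part v)),
-- meaning vertex a of the copy of H (part v) attached at v; the pair
-- (v , root (part v)) is the vertex v of G itself (root identified with v).
-- These pairs are enumerated as Fin (total ...) via `decode` (a bijection).

total : ∀ n → (Fin n → ℕ) → ℕ
total = sumℕ

decode : ∀ n (f : Fin n → ℕ) → Fin (total n f) → Σ (Fin n) (λ v → Fin (f v))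
decode (suc n) f i with splitAt (f zero) i
... | inj₁ a = zero , a
... | inj₂ b with decode n (f ∘ suc) b
...   | v , a = suc v , a

module Rooted {n ℓ : ℕ} (G : Graph n) (part : Fin n → Fin ℓ)
              (k : Fin ℓ → ℕ) (H : (i : Fin ℓ) → Graph (k i))
              (root : (i : Fin ℓ) → Fin (k i)) where

  Vtx : Set
  Vtx = Σ (Fin n) (λ v → Fin (k (part v)))

  isRoot : (v : Fin n) → Fin (k (part v)) → Bool
  isRoot v a = ⌊ a ≟ root (part v) ⌋

  sameCopy : (u : Fin n) → Fin (k (part u)) → (v : Fin n) → Fin (k (part v)) → Bool
  sameCopy u a v b with u ≟ v
  ... | yes refl = H (part u) a b
  ... | no _     = false

  adjΣ : Vtx → Vtx → Bool
  adjΣ (u , a) (v , b) = sameCopy u a v b ∨ (isRoot u a ∧ (isRoot v b ∧ G u v))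

  size : ℕ
  size = total n (λ v → k (part v))

  product : Graph size
  product i j = adjΣ (decode n (λ v → k (part v)) i) (decode n (λ v → k (part v)) j)

rootedProduct : ∀ {n ℓ} (G : Graph n) (part : Fin n → Fin ℓ)
  (k : Fin ℓ → ℕ) (H : (i : Fin ℓ) → Graph (k i)) (root : (i : Fin ℓ) → Fin (k i)) →
  Graph (total n (λ v → k (part v)))
rootedProduct G part k H root = Rooted.product G part k H root

-- Determinant (Laplace expansion along the first row) over any
-- ring-like signature; used both for scalars and for polynomials.

module Det {a} {A : Set a} (_+_ _*_ : A → A → A) (neg : A → A) (0a 1a : A) where
  altSum : ∀ m → (Fin m → A) → A
  altSum zero    t = 0a
  altSum (suc m) t = t zero + neg (altSum m (t ∘ suc))

  det : ∀ n → (Fin n → Fin n → A) → A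
  det zero    M = 1a
  det (suc n) M = altSum (suc n) (λ j → M zero j * det n (λ r c → M (suc r) (punchIn j c)))

module Mat {c ℓr : Level} (R : CommutativeRing c ℓr) where
  open CommutativeRing R using (Carrier; _≈_; _+_; _*_; -_; 0#; 1#)

  Matrix : ℕ → Set c
  Matrix n = Fin n → Fin n → Carrier

  sumR : ∀ n → (Fin n → Carrier) → Carrier
  sumR zero    f = 0#
  sumR (suc n) f = f zero + sumR n (f ∘ suc)

  _⊗_ : ∀ {n} → Matrix n → Matrix n → Matrix n
  _⊗_ {n} A B i j = sumR n (λ t → A i t * B t j)

  𝟙 : ∀ {n} → Matrix n
  𝟙 i j = if ⌊ i ≟ j ⌋ then 1# else 0#

  _≈ᴹ_ : ∀ {n} → Matrix n → Matrix n → Set ℓr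
  A ≈ᴹ B = ∀ i j → A i j ≈ B i j

  fromℕ : ℕ → Carrier
  fromℕ zero    = 0#
  fromℕ (suc m) = 1# + fromℕ m

  qLap : Carrier → ∀ {n} → Graph n → Matrix n
  qLap q G u v = if ⌊ u ≟ v ⌋ then q * fromℕ (deg G u)
                 else (if G u v then 1# else 0#)

  BlockDiagonal : ∀ {n ℓ} → (Fin n → Fin ℓ) → Matrix n → Set ℓr
  BlockDiagonal part S = ∀ u v → (part u ≡ part v → Data.Empty.⊥) → S u v ≈ 0#
    where import Data.Empty

  -- polynomials over R as coefficient lists (constant term first)
  Poly : Set c
  Poly = List Carrier

  padd : Poly → Poly → Poly
  padd []       q        = q
  padd (a ∷ p)  []       = a ∷ p
  padd (a ∷ p)  (b ∷ q)  = (a + b) ∷ padd p q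

  pneg : Poly → Poly
  pneg = map (-_)

  pmul : Poly → Poly → Poly
  pmul []      q = []
  pmul (a ∷ p) q = padd (map (a *_) q) (0# ∷ pmul p q)

  -- equality of polynomials (coefficientwise, trailing zeros ignored)
  _≈ₚ_ : Poly → Poly → Set ℓr
  []      ≈ₚ []      = ⊤
  []      ≈ₚ (b ∷ q) = (b ≈ 0#) × ([] ≈ₚ q)
  (a ∷ p) ≈ₚ []      = (a ≈ 0#) × (p ≈ₚ [])
  (a ∷ p) ≈ₚ (b ∷ q) = (a ≈ b) × (p ≈ₚ q)

  open Det padd pmul pneg [] (1# ∷ []) using () renaming (det to pdet)

  charPoly : ∀ {n} → Matrix n → Poly
  charPoly {n} M = pdet n (λ i j → padd (if ⌊ i ≟ j ⌋ then 0# ∷ 1# ∷ [] else []) (pneg (M i j ∷ [])))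

  Cospectral : ∀ {n} → Matrix n → Matrix n → Set ℓr
  Cospectral A B = charPoly A ≈ₚ charPoly B

{-# OPTIONS --safe #-}

-- Index the vertices of G ∘ H by pairs (v , a), a a vertex of the copy of H (part v) glued at v. The
-- q-Laplacian of G ∘ H is then X + Y_G, where X carries the q-Laplacian of H (part v) on the diagonal
-- block of v and Y_G carries that of G on the root coordinates. Since S is block diagonal, so is S⁻¹,
-- and Ŝ (u , a) (v , b) = S u v [a = b] is well defined, is inverted by the analogous matrix built from
-- S⁻¹, fixes X under conjugation and sends Y_G₁ to Y_G₂. Similar matrices have equal characteristic
-- polynomials because the determinant is multiplicative; for the Laplace-expansion determinant over an
-- arbitrary commutative ring, this holds because an alternating multilinear form vanishing at the
-- identity vanishes everywhere.

module Submission where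

open import Defs
open import Level using (Level; _⊔_)
open import Data.Nat as ℕ using (ℕ; zero; suc)
import Data.Nat.Properties as ℕ
open import Data.Fin as Fin using (Fin; zero; suc; punchIn; punchOut; toℕ; splitAt; _↑ˡ_; _↑ʳ_)
import Data.Fin.Properties as Fin
open import Data.Fin.Permutation.Components using (transpose)
open import Data.Vec.Functional using (updateAt)
open import Data.Vec.Functional.Properties
  using (updateAt-updates; updateAt-minimal; updateAt-id-local; updateAt-commutes)
open import Data.List using ([]; _∷_; map)
open import Data.Bool using (Bool; true; false; if_then_else_; _∧_)
import Data.Bool.Properties as Bool
open import Data.Maybe using (Maybe; just; nothing)
open import Data.Product using (Σ; _,_; proj₁; proj₂)
import Data.Product as Product
open import Data.Sum using (inj₁; inj₂)
open import Data.Unit.Polymorphic using (tt)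
open import Data.Empty using (⊥-elim)
open import Function using (_∘_; id)
open import Relation.Nullary using (Dec; yes; no)
open import Relation.Nullary.Decidable using (⌊_⌋; dec-true; dec-false)
open import Relation.Binary.PropositionalEquality as ≡ using (_≡_; _≢_)
open import Relation.Binary.Structures using (IsEquivalence)
open import Algebra.Bundles using (CommutativeRing)
open import Algebra.Solver.Ring.AlmostCommutativeRing using (fromCommutativeRing; _-Raw-AlmostCommutative⟶_)
import Algebra.Solver.Ring
import Algebra.Properties.CommutativeSemigroup
import Algebra.Properties.Monoid.Mult
import Algebra.Properties.Ring
import Algebra.Properties.Semiring.Mult.TCOptimised
import Algebra.Properties.Semiring.Sum
import Relation.Binary.Reasoning.Setoid as SetoidReasoning

transpose-at-first : ∀ {n} (r s : Fin n) → transpose r s r ≡ s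
transpose-at-first r s rewrite dec-true (r Fin.≟ r) ≡.refl = ≡.refl

transpose-at-second : ∀ {n} (r s : Fin n) → transpose r s s ≡ r
transpose-at-second r s with s Fin.≟ r
... | yes s≡r = s≡r
... | no _ rewrite dec-true (s Fin.≟ s) ≡.refl = ≡.refl

transpose-elsewhere : ∀ {n} {r s i : Fin n} → i ≢ r → i ≢ s → transpose r s i ≡ i
transpose-elsewhere {r = r} {s} {i} i≢r i≢s
  rewrite dec-false (i Fin.≟ r) i≢r | dec-false (i Fin.≟ s) i≢s = ≡.refl

transpose-suc : ∀ {n} (r s i : Fin n) → transpose (suc r) (suc s) (suc i) ≡ suc (transpose r s i)
transpose-suc r s i = by-cases (i Fin.≟ r) (i Fin.≟ s)
  where
  by-cases : Dec (i ≡ r) → Dec (i ≡ s) → transpose (suc r) (suc s) (suc i) ≡ suc (transpose r s i)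
  by-cases (yes ≡.refl) _ =
    ≡.trans (transpose-at-first (suc i) (suc s)) (≡.cong suc (≡.sym (transpose-at-first i s)))
  by-cases (no _) (yes ≡.refl) =
    ≡.trans (transpose-at-second (suc r) (suc i)) (≡.cong suc (≡.sym (transpose-at-second r i)))
  by-cases (no i≢r) (no i≢s) =
    ≡.trans (transpose-elsewhere (i≢r ∘ Fin.suc-injective) (i≢s ∘ Fin.suc-injective))
            (≡.cong suc (≡.sym (transpose-elsewhere i≢r i≢s)))

_[_]≔_ : ∀ {a} {A : Set a} {n} → (Fin n → A) → Fin n → A → (Fin n → A)
xs [ i ]≔ x = updateAt xs i (λ _ → x)

module _ {a} {A : Set a} {n} (xs : Fin n → A) {r s : Fin n} (u w : A) where
  updateTwice-first : r ≢ s → ((xs [ r ]≔ u) [ s ]≔ w) r ≡ u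
  updateTwice-first r≢s = ≡.trans (updateAt-minimal r s (xs [ r ]≔ u) r≢s) (updateAt-updates r xs)

  updateTwice-second : ((xs [ r ]≔ u) [ s ]≔ w) s ≡ w
  updateTwice-second = updateAt-updates s (xs [ r ]≔ u)

  updateTwice-elsewhere : ∀ {i} → i ≢ r → i ≢ s → ((xs [ r ]≔ u) [ s ]≔ w) i ≡ xs i
  updateTwice-elsewhere {i} i≢r i≢s =
    ≡.trans (updateAt-minimal i s (xs [ r ]≔ u) i≢s) (updateAt-minimal i r xs i≢r)

  ≗updateTwice : ∀ {ys : Fin n → A} → r ≢ s → ys r ≡ u → ys s ≡ w → (∀ i → i ≢ r → i ≢ s → ys i ≡ xs i) →
                 ∀ i → ys i ≡ ((xs [ r ]≔ u) [ s ]≔ w) i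
  ≗updateTwice r≢s ys-r ys-s ys-i i with i Fin.≟ s | i Fin.≟ r
  ... | yes ≡.refl | _          = ≡.trans ys-s (≡.sym updateTwice-second)
  ... | no i≢s     | yes ≡.refl = ≡.trans ys-r (≡.sym (updateTwice-first r≢s))
  ... | no i≢s     | no i≢r     = ≡.trans (ys-i i i≢r i≢s) (≡.sym (updateTwice-elsewhere i≢r i≢s))

punchIn-punchIn-comm : ∀ {m} {a b : Fin (suc (suc m))} (a≢b : a ≢ b) (b≢a : b ≢ a) (c : Fin m) →
                       punchIn a (punchIn (punchOut a≢b) c) ≡ punchIn b (punchIn (punchOut b≢a) c)
punchIn-punchIn-comm {a = zero}  {zero}  a≢b _ c = ⊥-elim (a≢b ≡.refl)
punchIn-punchIn-comm {a = zero}  {suc b} _   _ c = ≡.refl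
punchIn-punchIn-comm {a = suc a} {zero}  _   _ c = ≡.refl
punchIn-punchIn-comm {m = suc m} {suc a} {suc b} _ _ zero = ≡.refl
punchIn-punchIn-comm {m = suc m} {suc a} {suc b} a≢b b≢a (suc c) =
  ≡.cong suc (punchIn-punchIn-comm (a≢b ∘ ≡.cong suc) (b≢a ∘ ≡.cong suc) c)

non-surjective⇒collision : ∀ {n} (f : Fin n → Fin n) (r : Fin n) → (∀ s → f s ≢ r) →
                           Σ (Fin n) λ i → Σ (Fin n) λ j → i ≢ j Product.× f i ≡ f j
non-surjective⇒collision {suc n} f r r∉f
  with i , j , i<j , eq ← Fin.pigeonhole (ℕ.n<1+n n) (λ i → punchOut (r∉f i ∘ ≡.sym))
  = i , j , Fin.<⇒≢ i<j , Fin.punchOut-injective (r∉f i ∘ ≡.sym) (r∉f j ∘ ≡.sym) eq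

encode : ∀ n (f : Fin n → ℕ) → Σ (Fin n) (Fin ∘ f) → Fin (total n f)
encode (suc n) f (zero  , a) = a ↑ˡ total n (f ∘ suc)
encode (suc n) f (suc v , a) = f zero ↑ʳ encode n (f ∘ suc) (v , a)

decode-↑ˡ : ∀ n (f : Fin (suc n) → ℕ) a → decode (suc n) f (a ↑ˡ total n (f ∘ suc)) ≡ (zero , a)
decode-↑ˡ n f a rewrite Fin.splitAt-↑ˡ (f zero) a (total n (f ∘ suc)) = ≡.refl

decode-↑ʳ : ∀ n (f : Fin (suc n) → ℕ) i → let (v , a) = decode n (f ∘ suc) i in
            decode (suc n) f (f zero ↑ʳ i) ≡ (suc v , a)
decode-↑ʳ n f i rewrite Fin.splitAt-↑ʳ (f zero) (total n (f ∘ suc)) i = ≡.refl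

encode-decode : ∀ n (f : Fin n → ℕ) i → encode n f (decode n f i) ≡ i
encode-decode (suc n) f i with splitAt (f zero) i in eq
... | inj₁ a = ≡.trans (≡.sym (≡.cong (Fin.join (f zero) _) eq)) (Fin.join-splitAt (f zero) _ i)
... | inj₂ b = ≡.trans (≡.cong (f zero ↑ʳ_) (encode-decode n (f ∘ suc) b))
                       (≡.trans (≡.sym (≡.cong (Fin.join (f zero) _) eq)) (Fin.join-splitAt (f zero) _ i))

decode-injective : ∀ n (f : Fin n → ℕ) {i j} → decode n f i ≡ decode n f j → i ≡ j
decode-injective n f {i} {j} eq =
  ≡.trans (≡.sym (encode-decode n f i)) (≡.trans (≡.cong (encode n f) eq) (encode-decode n f j))

-- The ring solver needs coefficients with decidable equality; ℤ maps into every commutative ring.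
module IntegerCoefficients {c ℓ : Level} (R : CommutativeRing c ℓ) where
  open import Data.Integer as ℤ using (ℤ; +_; -[1+_]; _⊖_)
  import Data.Integer.Properties as ℤ
  open CommutativeRing R hiding (zero)
  open Algebra.Properties.Semiring.Mult.TCOptimised semiring using (_×_; 1+×; ×-homo-+; ×1-homo-*)
  open Algebra.Properties.Ring ring using (-0#≈0#; -‿involutive; -‿distribˡ-*; -‿distribʳ-*; -‿+-comm)
  open Algebra.Properties.CommutativeSemigroup +-commutativeSemigroup using (interchange)
  open SetoidReasoning setoid

  ⟦_⟧ : ℤ → Carrier
  ⟦ + n ⟧      = n × 1#
  ⟦ -[1+ n ] ⟧ = - (suc n × 1#)

  ⟦-+⟧ : ∀ n → ⟦ ℤ.- (+ n) ⟧ ≈ - (n × 1#)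
  ⟦-+⟧ zero    = sym -0#≈0#
  ⟦-+⟧ (suc n) = refl

  ⟦⊖⟧ : ∀ m n → ⟦ m ⊖ n ⟧ ≈ m × 1# - n × 1#
  ⟦⊖⟧ m       zero    = sym (trans (+-congˡ -0#≈0#) (+-identityʳ _))
  ⟦⊖⟧ zero    (suc n) = sym (+-identityˡ _)
  ⟦⊖⟧ (suc m) (suc n) = begin
    ⟦ suc m ⊖ suc n ⟧                  ≡⟨ ≡.cong ⟦_⟧ (ℤ.[1+m]⊖[1+n]≡m⊖n m n) ⟩
    ⟦ m ⊖ n ⟧                          ≈⟨ ⟦⊖⟧ m n ⟩
    m × 1# - n × 1#                    ≈⟨ cancel (m × 1#) (n × 1#) ⟨
    (1# + m × 1#) - (1# + n × 1#)      ≈⟨ +-cong (1+× m 1#) (-‿cong (1+× n 1#)) ⟨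
    suc m × 1# - suc n × 1#            ∎
    where
    cancel : ∀ a b → (1# + a) - (1# + b) ≈ a - b
    cancel a b = begin
      (1# + a) - (1# + b)      ≈⟨ +-congˡ (-‿+-comm 1# b) ⟨
      (1# + a) + (- 1# - b)    ≈⟨ interchange 1# a (- 1#) (- b) ⟩
      (1# - 1#) + (a - b)      ≈⟨ +-congʳ (-‿inverseʳ 1#) ⟩
      0# + (a - b)             ≈⟨ +-identityˡ _ ⟩
      a - b                    ∎

  ⟦⟧-homo-+ : ∀ i j → ⟦ i ℤ.+ j ⟧ ≈ ⟦ i ⟧ + ⟦ j ⟧
  ⟦⟧-homo-+ (+ m)    (+ n)    = ×-homo-+ 1# m n
  ⟦⟧-homo-+ (+ m)    -[1+ n ] = ⟦⊖⟧ m (suc n)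
  ⟦⟧-homo-+ -[1+ m ] (+ n)    = trans (⟦⊖⟧ n (suc m)) (+-comm _ _)
  ⟦⟧-homo-+ -[1+ m ] -[1+ n ] = begin
    - (suc (suc (m ℕ.+ n)) × 1#)       ≡⟨ ≡.cong (λ k → - (k × 1#)) (ℕ.+-suc (suc m) n) ⟨
    - ((suc m ℕ.+ suc n) × 1#)         ≈⟨ -‿cong (×-homo-+ 1# (suc m) (suc n)) ⟩
    - (suc m × 1# + suc n × 1#)        ≈⟨ -‿+-comm _ _ ⟨
    - (suc m × 1#) + - (suc n × 1#)    ∎

  ⟦⟧-homo-- : ∀ i → ⟦ ℤ.- i ⟧ ≈ - ⟦ i ⟧
  ⟦⟧-homo-- (+ n)    = ⟦-+⟧ n
  ⟦⟧-homo-- -[1+ n ] = sym (-‿involutive _)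

  ⟦⟧-homo-* : ∀ i j → ⟦ i ℤ.* j ⟧ ≈ ⟦ i ⟧ * ⟦ j ⟧
  ⟦⟧-homo-* (+ m) (+ n) = begin
    ⟦ + m ℤ.* + n ⟧                 ≡⟨ ≡.cong ⟦_⟧ (ℤ.+◃n≡+n (m ℕ.* n)) ⟩
    (m ℕ.* n) × 1#                  ≈⟨ ×1-homo-* m n ⟩
    (m × 1#) * (n × 1#)             ∎
  ⟦⟧-homo-* (+ m) -[1+ n ] = begin
    ⟦ + m ℤ.* -[1+ n ] ⟧            ≡⟨ ≡.cong ⟦_⟧ (ℤ.-◃n≡-n (m ℕ.* suc n)) ⟩
    ⟦ ℤ.- (+ (m ℕ.* suc n)) ⟧       ≈⟨ ⟦-+⟧ (m ℕ.* suc n) ⟩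
    - ((m ℕ.* suc n) × 1#)          ≈⟨ -‿cong (×1-homo-* m (suc n)) ⟩
    - ((m × 1#) * (suc n × 1#))     ≈⟨ -‿distribʳ-* _ _ ⟩
    (m × 1#) * - (suc n × 1#)       ∎
  ⟦⟧-homo-* -[1+ m ] (+ n) = begin
    ⟦ -[1+ m ] ℤ.* + n ⟧            ≡⟨ ≡.cong ⟦_⟧ (ℤ.-◃n≡-n (suc m ℕ.* n)) ⟩
    ⟦ ℤ.- (+ (suc m ℕ.* n)) ⟧       ≈⟨ ⟦-+⟧ (suc m ℕ.* n) ⟩
    - ((suc m ℕ.* n) × 1#)          ≈⟨ -‿cong (×1-homo-* (suc m) n) ⟩
    - ((suc m × 1#) * (n × 1#))     ≈⟨ -‿distribˡ-* _ _ ⟩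
    - (suc m × 1#) * (n × 1#)       ∎
  ⟦⟧-homo-* -[1+ m ] -[1+ n ] = begin
    (suc m ℕ.* suc n) × 1#              ≈⟨ ×1-homo-* (suc m) (suc n) ⟩
    (suc m × 1#) * (suc n × 1#)         ≈⟨ -‿involutive _ ⟨
    - - ((suc m × 1#) * (suc n × 1#))   ≈⟨ -‿cong (-‿distribˡ-* _ _) ⟩
    - (- (suc m × 1#) * (suc n × 1#))   ≈⟨ -‿distribʳ-* _ _ ⟩
    - (suc m × 1#) * - (suc n × 1#)     ∎

  homomorphism : ℤ.+-*-rawRing -Raw-AlmostCommutative⟶ fromCommutativeRing R
  homomorphism = record
    { ⟦_⟧ = ⟦_⟧ ; +-homo = ⟦⟧-homo-+ ; *-homo = ⟦⟧-homo-* ; -‿homo = ⟦⟧-homo--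
    ; 0-homo = refl ; 1-homo = refl }

  equal? : ∀ i j → Maybe (⟦ i ⟧ ≈ ⟦ j ⟧)
  equal? i j with i ℤ.≟ j
  ... | yes ≡.refl = just refl
  ... | no _       = nothing

  open Algebra.Solver.Ring ℤ.+-*-rawRing (fromCommutativeRing R) homomorphism equal? public
    using (solve; _:+_; _:*_; :-_; _:=_)

module FiniteSums {c ℓ : Level} (R : CommutativeRing c ℓ) where
  open CommutativeRing R hiding (zero)
  open Mat R using (sumR; fromℕ)
  open Algebra.Properties.Semiring.Sum semiring
    using (sum; sum-cong-≋; sum-replicate-zero; ∑-distrib-+; ∑-comm; *-distribˡ-sum; *-distribʳ-sum; sum-remove)
  open Algebra.Properties.Ring ring using (-1*x≈-x)
  open Algebra.Properties.Monoid.Mult +-monoid using (_×_; ×-homo-+)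
  open SetoidReasoning setoid

  sumR≡sum : ∀ {n} (f : Fin n → Carrier) → sumR n f ≡ sum f
  sumR≡sum {zero}  f = ≡.refl
  sumR≡sum {suc n} f = ≡.cong (f zero +_) (sumR≡sum (f ∘ suc))

  sumR-cong : ∀ n {f g : Fin n → Carrier} → (∀ i → f i ≈ g i) → sumR n f ≈ sumR n g
  sumR-cong n {f} {g} f≈g rewrite sumR≡sum f | sumR≡sum g = sum-cong-≋ f≈g

  sumR-zero : ∀ n {f : Fin n → Carrier} → (∀ i → f i ≈ 0#) → sumR n f ≈ 0#
  sumR-zero n f≈0 =
    trans (sumR-cong n f≈0) (trans (reflexive (sumR≡sum {n} (λ _ → 0#))) (sum-replicate-zero n))

  sumR-+ : ∀ n (f g : Fin n → Carrier) → sumR n (λ i → f i + g i) ≈ sumR n f + sumR n g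
  sumR-+ n f g rewrite sumR≡sum (λ i → f i + g i) | sumR≡sum f | sumR≡sum g = ∑-distrib-+ f g

  *-distribˡ-sumR : ∀ n x (f : Fin n → Carrier) → x * sumR n f ≈ sumR n (λ i → x * f i)
  *-distribˡ-sumR n x f rewrite sumR≡sum f | sumR≡sum (λ i → x * f i) = *-distribˡ-sum x f

  sumR-linear : ∀ n x (f g : Fin n → Carrier) → sumR n (λ i → x * f i + g i) ≈ x * sumR n f + sumR n g
  sumR-linear n x f g = trans (sumR-+ n (λ i → x * f i) g) (+-congʳ (sym (*-distribˡ-sumR n x f)))

  *-distribʳ-sumR : ∀ n x (f : Fin n → Carrier) → sumR n f * x ≈ sumR n (λ i → f i * x)
  *-distribʳ-sumR n x f rewrite sumR≡sum f | sumR≡sum (λ i → f i * x) = *-distribʳ-sum x f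

  -‿distrib-sumR : ∀ n (f : Fin n → Carrier) → - sumR n f ≈ sumR n (λ i → - f i)
  -‿distrib-sumR n f =
    trans (sym (-1*x≈-x _)) (trans (*-distribˡ-sumR n (- 1#) f) (sumR-cong n (λ i → -1*x≈-x (f i))))

  sumR-comm : ∀ m n (f : Fin m → Fin n → Carrier) →
              sumR m (λ i → sumR n (f i)) ≈ sumR n (λ j → sumR m (λ i → f i j))
  sumR-comm m n f = begin
    sumR m (λ i → sumR n (f i))         ≈⟨ sumR-cong m (λ i → reflexive (sumR≡sum (f i))) ⟩
    sumR m (λ i → sum (f i))            ≡⟨ sumR≡sum (λ i → sum (f i)) ⟩
    sum (λ i → sum (f i))               ≈⟨ ∑-comm f ⟩
    sum (λ j → sum (λ i → f i j))       ≡⟨ sumR≡sum (λ j → sum (λ i → f i j)) ⟨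
    sumR n (λ j → sum (λ i → f i j))    ≈⟨ sumR-cong n (λ j → reflexive (sumR≡sum (λ i → f i j))) ⟨
    sumR n (λ j → sumR m (λ i → f i j)) ∎

  sumR-single : ∀ n (f : Fin n → Carrier) (a : Fin n) → (∀ i → i ≢ a → f i ≈ 0#) → sumR n f ≈ f a
  sumR-single (suc n) f a f≈0 rewrite sumR≡sum f = begin
    sum f                            ≈⟨ sum-remove f ⟩
    f a + sum (f ∘ punchIn a)        ≡⟨ ≡.cong (f a +_) (sumR≡sum (f ∘ punchIn a)) ⟨
    f a + sumR n (f ∘ punchIn a)     ≈⟨ +-congˡ (sumR-zero n (λ j → f≈0 (punchIn a j) (Fin.punchInᵢ≢i a j))) ⟩
    f a + 0#                         ≈⟨ +-identityʳ _ ⟩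
    f a                              ∎

  -- By peeling off the first row and column: symmetrising instead would need 2 to be invertible.
  sumR-antisymmetric : ∀ m (g : Fin m → Fin m → Carrier) → (∀ a → g a a ≈ 0#) →
                       (∀ a b → a ≢ b → g a b + g b a ≈ 0#) → sumR m (λ a → sumR m (g a)) ≈ 0#
  sumR-antisymmetric zero    g diag offdiag = refl
  sumR-antisymmetric (suc m) g diag offdiag = begin
    (g zero zero + X) + sumR m (λ a → g (suc a) zero + sumR m (g (suc a) ∘ suc))
      ≈⟨ +-congˡ (sumR-+ m (λ a → g (suc a) zero) (λ a → sumR m (g (suc a) ∘ suc))) ⟩
    (g zero zero + X) + (Y + sumR m (λ a → sumR m (g (suc a) ∘ suc)))
      ≈⟨ +-cong (+-congʳ (diag zero)) (+-congˡ (sumR-antisymmetric m (λ a b → g (suc a) (suc b)) (diag ∘ suc)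
                  (λ a b a≢b → offdiag (suc a) (suc b) (a≢b ∘ Fin.suc-injective)))) ⟩
    (0# + X) + (Y + 0#)                                          ≈⟨ +-cong (+-identityˡ X) (+-identityʳ Y) ⟩
    X + Y                                                        ≈⟨ sumR-+ m _ _ ⟨
    sumR m (λ b → g zero (suc b) + g (suc b) zero)               ≈⟨ sumR-zero m (λ b → offdiag zero (suc b) (λ ())) ⟩
    0#                                                           ∎
    where
    X Y : Carrier
    X = sumR m (g zero ∘ suc)
    Y = sumR m (λ a → g (suc a) zero)

  sumR-↑ : ∀ m p (h : Fin (m ℕ.+ p) → Carrier) →
           sumR (m ℕ.+ p) h ≈ sumR m (λ i → h (i ↑ˡ p)) + sumR p (λ j → h (m ↑ʳ j))
  sumR-↑ zero    p h = sym (+-identityˡ _)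
  sumR-↑ (suc m) p h = trans (+-congˡ (sumR-↑ m p (h ∘ suc))) (sym (+-assoc _ _ _))

  sumR-decode : ∀ n (f : Fin n → ℕ) (g : Σ (Fin n) (Fin ∘ f) → Carrier) →
                sumR (total n f) (g ∘ decode n f) ≈ sumR n (λ v → sumR (f v) (λ a → g (v , a)))
  sumR-decode zero    f g = refl
  sumR-decode (suc n) f g = trans (sumR-↑ (f zero) (total n (f ∘ suc)) _)
    (+-cong (sumR-cong (f zero) (λ a → reflexive (≡.cong g (decode-↑ˡ n f a))))
            (trans (sumR-cong (total n (f ∘ suc)) (λ i → reflexive (≡.cong g (decode-↑ʳ n f i))))
                   (sumR-decode n (f ∘ suc) (λ x → g (suc (proj₁ x) , proj₂ x)))))

  fromℕ≡× : ∀ m → fromℕ m ≡ m × 1#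
  fromℕ≡× zero    = ≡.refl
  fromℕ≡× (suc m) = ≡.cong (1# +_) (fromℕ≡× m)

  fromℕ-sumℕ : ∀ n (f : Fin n → ℕ) → fromℕ (sumℕ n f) ≈ sumR n (fromℕ ∘ f)
  fromℕ-sumℕ zero    f = refl
  fromℕ-sumℕ (suc n) f = begin
    fromℕ (f zero ℕ.+ sumℕ n (f ∘ suc))            ≡⟨ fromℕ≡× (f zero ℕ.+ sumℕ n (f ∘ suc)) ⟩
    (f zero ℕ.+ sumℕ n (f ∘ suc)) × 1#              ≈⟨ ×-homo-+ 1# (f zero) _ ⟩
    f zero × 1# + sumℕ n (f ∘ suc) × 1#             ≡⟨ ≡.cong₂ _+_ (fromℕ≡× (f zero)) (fromℕ≡× (sumℕ n (f ∘ suc))) ⟨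
    fromℕ (f zero) + fromℕ (sumℕ n (f ∘ suc))       ≈⟨ +-congˡ (fromℕ-sumℕ n (f ∘ suc)) ⟩
    fromℕ (f zero) + sumR n (fromℕ ∘ f ∘ suc)       ∎

module MatrixAlgebra {c ℓ : Level} (R : CommutativeRing c ℓ) where
  open CommutativeRing R hiding (zero)
  open Mat R
  open FiniteSums R
  open IntegerCoefficients R using (solve; _:+_; _:*_; :-_; _:=_)
  open SetoidReasoning setoid

  𝟙-diag : ∀ {n} (i : Fin n) → 𝟙 i i ≈ 1#
  𝟙-diag i with i Fin.≟ i
  ... | yes _   = refl
  ... | no i≢i = ⊥-elim (i≢i ≡.refl)

  𝟙-offDiag : ∀ {n} {i j : Fin n} → i ≢ j → 𝟙 i j ≈ 0#
  𝟙-offDiag {i = i} {j} i≢j with i Fin.≟ j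
  ... | yes i≡j = ⊥-elim (i≢j i≡j)
  ... | no _    = refl

  𝟙-cong : ∀ {m n} {i j : Fin m} {i′ j′ : Fin n} → (i ≡ j → i′ ≡ j′) → (i′ ≡ j′ → i ≡ j) → 𝟙 i j ≈ 𝟙 i′ j′
  𝟙-cong {i = i} {j} {i′} {j′} to from with i Fin.≟ j | i′ Fin.≟ j′
  ... | yes _   | yes _    = refl
  ... | no _    | no _     = refl
  ... | yes i≡j | no i′≢j′ = ⊥-elim (i′≢j′ (to i≡j))
  ... | no i≢j  | yes i′≡j′ = ⊥-elim (i≢j (from i′≡j′))

  𝟙-sym : ∀ {n} (i j : Fin n) → 𝟙 i j ≈ 𝟙 j i
  𝟙-sym i j = 𝟙-cong ≡.sym ≡.sym

  sumR-𝟙ˡ : ∀ {n} (i : Fin n) (f : Fin n → Carrier) → sumR n (λ j → 𝟙 i j * f j) ≈ f i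
  sumR-𝟙ˡ {n} i f = begin
    sumR n (λ j → 𝟙 i j * f j) ≈⟨ sumR-single n _ i (λ j j≢i → trans (*-congʳ (𝟙-offDiag (j≢i ∘ ≡.sym))) (zeroˡ _)) ⟩
    𝟙 i i * f i                ≈⟨ trans (*-congʳ (𝟙-diag i)) (*-identityˡ _) ⟩
    f i                        ∎

  sumR-𝟙ʳ : ∀ {n} (i : Fin n) (f : Fin n → Carrier) → sumR n (λ j → f j * 𝟙 j i) ≈ f i
  sumR-𝟙ʳ {n} i f = trans (sumR-cong n (λ j → trans (*-comm _ _) (*-congʳ (𝟙-sym j i)))) (sumR-𝟙ˡ i f)

  ≈ᴹ-refl : ∀ {n} {A : Matrix n} → A ≈ᴹ A
  ≈ᴹ-refl i j = refl

  ≈ᴹ-sym : ∀ {n} {A B : Matrix n} → A ≈ᴹ B → B ≈ᴹ A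
  ≈ᴹ-sym A≈B i j = sym (A≈B i j)

  ≈ᴹ-trans : ∀ {n} {A B C : Matrix n} → A ≈ᴹ B → B ≈ᴹ C → A ≈ᴹ C
  ≈ᴹ-trans A≈B B≈C i j = trans (A≈B i j) (B≈C i j)

  ⊗-cong : ∀ {n} {A A′ B B′ : Matrix n} → A ≈ᴹ A′ → B ≈ᴹ B′ → (A ⊗ B) ≈ᴹ (A′ ⊗ B′)
  ⊗-cong {n} A≈A′ B≈B′ i j = sumR-cong n (λ t → *-cong (A≈A′ i t) (B≈B′ t j))

  ⊗-identityˡ : ∀ {n} (A : Matrix n) → (𝟙 ⊗ A) ≈ᴹ A
  ⊗-identityˡ A i j = sumR-𝟙ˡ i (λ t → A t j)

  ⊗-identityʳ : ∀ {n} (A : Matrix n) → (A ⊗ 𝟙) ≈ᴹ A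
  ⊗-identityʳ A i j = sumR-𝟙ʳ j (A i)

  -- M read at natural-number indices, with the junk value 0# outside its range.
  atℕ : ∀ m → Matrix m → ℕ → ℕ → Carrier
  atℕ m M x y with x ℕ.<? m | y ℕ.<? m
  ... | yes x<m | yes y<m = M (Fin.fromℕ< x<m) (Fin.fromℕ< y<m)
  ... | _       | _       = 0#

  atℕ-toℕ : ∀ m (M : Matrix m) a b → atℕ m M (toℕ a) (toℕ b) ≈ M a b
  atℕ-toℕ m M a b with toℕ a ℕ.<? m | toℕ b ℕ.<? m
  ... | yes a<m | yes b<m = reflexive (≡.cong₂ M (Fin.fromℕ<-toℕ a a<m) (Fin.fromℕ<-toℕ b b<m))
  ... | no a≮m  | _       = ⊥-elim (a≮m (Fin.toℕ<n a))
  ... | yes _   | no b≮m  = ⊥-elim (b≮m (Fin.toℕ<n b))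

  _·𝟙-_ : Carrier → ∀ {n} → Matrix n → Matrix n
  (x ·𝟙- M) i j = x * 𝟙 i j - M i j

  conjugate-·𝟙- : ∀ {n} (T T′ M : Matrix n) x → (T ⊗ T′) ≈ᴹ 𝟙 →
                  ((T ⊗ (x ·𝟙- M)) ⊗ T′) ≈ᴹ (x ·𝟙- ((T ⊗ M) ⊗ T′))
  conjugate-·𝟙- {n} T T′ M x TT′≈𝟙 i j = begin
    sumR n (λ t → (T ⊗ (x ·𝟙- M)) i t * T′ t j)
      ≈⟨ sumR-cong n (λ t → trans (*-congʳ (left t)) (distribʳ-sub (T i t) ((T ⊗ M) i t) (T′ t j))) ⟩
    sumR n (λ t → x * (T i t * T′ t j) - (T ⊗ M) i t * T′ t j)  ≈⟨ collect _ _ ⟩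
    x * (T ⊗ T′) i j - ((T ⊗ M) ⊗ T′) i j                        ≈⟨ +-congʳ (*-congˡ (TT′≈𝟙 i j)) ⟩
    x * 𝟙 i j - ((T ⊗ M) ⊗ T′) i j                               ∎
    where
    collect : ∀ (f g : Fin n → Carrier) → sumR n (λ t → x * f t - g t) ≈ x * sumR n f - sumR n g
    collect f g = trans (sumR-linear n x f (λ t → - g t)) (+-congˡ (sym (-‿distrib-sumR n g)))
    distribʳ-sub : ∀ a b d → (x * a - b) * d ≈ x * (a * d) - b * d
    distribʳ-sub = solve 4 (λ x a b d → (x :* a :+ :- b) :* d := x :* (a :* d) :+ :- (b :* d)) refl x
    left : ∀ t → (T ⊗ (x ·𝟙- M)) i t ≈ x * T i t - (T ⊗ M) i t
    left t = begin
      sumR n (λ s → T i s * (x * 𝟙 s t - M s t))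
        ≈⟨ sumR-cong n (λ s → solve 4 (λ a x d m → a :* (x :* d :+ :- m) := x :* (a :* d) :+ :- (a :* m))
                                       refl (T i s) x (𝟙 s t) (M s t)) ⟩
      sumR n (λ s → x * (T i s * 𝟙 s t) - T i s * M s t)  ≈⟨ collect _ _ ⟩
      x * sumR n (λ s → T i s * 𝟙 s t) - (T ⊗ M) i t      ≈⟨ +-congʳ (*-congˡ (sumR-𝟙ʳ t (T i))) ⟩
      x * T i t - (T ⊗ M) i t                             ∎

module Determinant {c ℓ : Level} (R : CommutativeRing c ℓ) where
  open CommutativeRing R hiding (zero)
  open Mat R
  open Det _+_ _*_ -_ 0# 1# using (altSum; det)
  open FiniteSums R
  open MatrixAlgebra R
  open IntegerCoefficients R using (solve; _:+_; _:*_; :-_; _:=_)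
  open Algebra.Properties.Ring ring
    using (-‿distribˡ-*; -‿distribʳ-*; -1*x≈-x; -‿involutive; -0#≈0#; +-inverseʳ-unique; x∙y⁻¹≈ε⇒x≈y)
  open SetoidReasoning setoid

  Row : ℕ → Set c
  Row n = Fin n → Carrier

  sign : ∀ {m} → Fin m → Carrier
  sign zero    = 1#
  sign (suc j) = - sign j

  altSum≈sumR : ∀ m (t : Fin m → Carrier) → altSum m t ≈ sumR m (λ j → sign j * t j)
  altSum≈sumR zero    t = refl
  altSum≈sumR (suc m) t = +-cong (sym (*-identityˡ _)) (begin
    - altSum m (t ∘ suc)                   ≈⟨ -‿cong (altSum≈sumR m (t ∘ suc)) ⟩
    - sumR m (λ j → sign j * t (suc j))    ≈⟨ -‿distrib-sumR m _ ⟩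
    sumR m (λ j → - (sign j * t (suc j)))  ≈⟨ sumR-cong m (λ j → -‿distribˡ-* _ _) ⟩
    sumR m (λ j → - sign j * t (suc j))    ∎)

  minor : ∀ {n} → Fin (suc n) → Matrix (suc n) → Matrix n
  minor j M r c = M (suc r) (punchIn j c)

  laplaceTerm : ∀ n → Matrix (suc n) → Fin (suc n) → Carrier
  laplaceTerm n M j = M zero j * det n (minor j M)

  det-expansion : ∀ n (M : Matrix (suc n)) → det (suc n) M ≈ sumR (suc n) (λ j → sign j * laplaceTerm n M j)
  det-expansion n M = altSum≈sumR (suc n) (laplaceTerm n M)

  det-cong : ∀ n {M N : Matrix n} → M ≈ᴹ N → det n M ≈ det n N
  det-cong zero    M≈N = refl
  det-cong (suc n) {M} {N} M≈N = begin
    det (suc n) M                                    ≈⟨ det-expansion n M ⟩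
    sumR (suc n) (λ j → sign j * laplaceTerm n M j)  ≈⟨ sumR-cong (suc n) term≈ ⟩
    sumR (suc n) (λ j → sign j * laplaceTerm n N j)  ≈⟨ det-expansion n N ⟨
    det (suc n) N                                    ∎
    where
    term≈ : ∀ j → sign j * laplaceTerm n M j ≈ sign j * laplaceTerm n N j
    term≈ j = *-congˡ (*-cong (M≈N zero j) (det-cong n (λ r c → M≈N (suc r) (punchIn j c))))

  RowsAgreeOff : ∀ {n} → Fin n → Matrix n → Matrix n → Set ℓ
  RowsAgreeOff r M N = ∀ i → i ≢ r → ∀ c → M i c ≈ N i c

  RowLinear : ∀ n → (Matrix n → Carrier) → Set (c ⊔ ℓ)
  RowLinear n F = ∀ r x (M U W : Matrix n) → RowsAgreeOff r M U → RowsAgreeOff r M W →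
                  (∀ c → M r c ≈ x * U r c + W r c) → F M ≈ x * F U + F W

  det-linear-in-terms : ∀ n x (M U W : Matrix (suc n)) →
    (∀ j → laplaceTerm n M j ≈ x * laplaceTerm n U j + laplaceTerm n W j) →
    det (suc n) M ≈ x * det (suc n) U + det (suc n) W
  det-linear-in-terms n x M U W terms = begin
    det (suc n) M                                          ≈⟨ det-expansion n M ⟩
    sumR (suc n) (λ j → sign j * laplaceTerm n M j)
      ≈⟨ sumR-cong (suc n) (λ j → trans (*-congˡ (terms j)) (distribute (sign j) _ _)) ⟩
    sumR (suc n) (λ j → x * (sign j * laplaceTerm n U j) + sign j * laplaceTerm n W j)
      ≈⟨ sumR-linear (suc n) x (λ j → sign j * laplaceTerm n U j) (λ j → sign j * laplaceTerm n W j) ⟩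
    x * sumR (suc n) (λ j → sign j * laplaceTerm n U j) + sumR (suc n) (λ j → sign j * laplaceTerm n W j)
      ≈⟨ +-cong (*-congˡ (det-expansion n U)) (det-expansion n W) ⟨
    x * det (suc n) U + det (suc n) W                      ∎
    where
    distribute : ∀ s u w → s * (x * u + w) ≈ x * (s * u) + s * w
    distribute = solve 4 (λ x s u w → s :* (x :* u :+ w) := x :* (s :* u) :+ s :* w) refl x

  det-linear : ∀ n → RowLinear n (det n)
  det-linear (suc n) zero x M U W M≈U M≈W row₀ = det-linear-in-terms n x M U W λ j →
    let dU = det-cong n (λ r c → M≈U (suc r) (λ ()) (punchIn j c))
        dW = det-cong n (λ r c → M≈W (suc r) (λ ()) (punchIn j c))
    in trans (*-cong (row₀ j) refl)
      (trans (solve 4 (λ x u w d → (x :* u :+ w) :* d := x :* (u :* d) :+ w :* d) refl x (U zero j) (W zero j) _)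
             (+-cong (*-congˡ (*-congˡ dU)) (*-congˡ dW)))
  det-linear (suc n) (suc r) x M U W M≈U M≈W rowᵣ = det-linear-in-terms n x M U W λ j →
    let minor-linear = det-linear n r x (minor j M) (minor j U) (minor j W)
          (λ i i≢r c → M≈U (suc i) (i≢r ∘ Fin.suc-injective) (punchIn j c))
          (λ i i≢r c → M≈W (suc i) (i≢r ∘ Fin.suc-injective) (punchIn j c))
          (λ c → rowᵣ (punchIn j c))
    in trans (*-congˡ minor-linear)
      (trans (solve 4 (λ m x u w → m :* (x :* u :+ w) := x :* (m :* u) :+ m :* w) refl (M zero j) x _ _)
             (+-cong (*-congˡ (*-congʳ (M≈U zero (λ ()) j))) (*-congʳ (M≈W zero (λ ()) j))))

  record IsMultilinear (n : ℕ) (F : Matrix n → Carrier) : Set (c ⊔ ℓ) where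
    field
      cong   : ∀ {M N} → M ≈ᴹ N → F M ≈ F N
      linear : RowLinear n F

  Alternating : ∀ n → (Matrix n → Carrier) → Set (c ⊔ ℓ)
  Alternating n F = ∀ M (r s : Fin n) → r ≢ s → (∀ col → M r col ≈ M s col) → F M ≈ 0#

  ≗⇒≈ᴹ : ∀ {n} {M N : Matrix n} → (∀ i → M i ≡ N i) → M ≈ᴹ N
  ≗⇒≈ᴹ M≗N i col = reflexive (≡.cong-app (M≗N i) col)

  []≔-at : ∀ {n} (M : Matrix n) r u col → (M [ r ]≔ u) r col ≈ u col
  []≔-at M r u col = reflexive (≡.cong-app (updateAt-updates r M) col)

  []≔-agreeOff : ∀ {n} (M : Matrix n) r u v → RowsAgreeOff r (M [ r ]≔ u) (M [ r ]≔ v)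
  []≔-agreeOff M r u v i i≢r = ≗⇒≈ᴹ (λ _ → ≡.trans (updateAt-minimal i r M i≢r) (≡.sym (updateAt-minimal i r M i≢r))) i

  []≔-cong : ∀ {n} (M : Matrix n) r {u v : Row n} → (∀ col → u col ≈ v col) → (M [ r ]≔ u) ≈ᴹ (M [ r ]≔ v)
  []≔-cong M r {u} {v} u≈v i col with i Fin.≟ r
  ... | yes ≡.refl = trans ([]≔-at M i u col) (trans (u≈v col) (sym ([]≔-at M i v col)))
  ... | no i≢r     = []≔-agreeOff M r u v i i≢r col

  module MultilinearProperties {n} {F : Matrix n → Carrier} (F-multilinear : IsMultilinear n F) where
    open IsMultilinear F-multilinear public

    linear-at : ∀ (M : Matrix n) r x (u v : Row n) →
                F (M [ r ]≔ (λ col → x * u col + v col)) ≈ x * F (M [ r ]≔ u) + F (M [ r ]≔ v)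
    linear-at M r x u v = linear r x _ _ _ ([]≔-agreeOff M r _ u) ([]≔-agreeOff M r _ v) λ col →
      trans ([]≔-at M r _ col) (sym (+-cong (*-congˡ ([]≔-at M r u col)) ([]≔-at M r v col)))

    additive-at : ∀ (M : Matrix n) r (u v : Row n) →
                  F (M [ r ]≔ (λ col → u col + v col)) ≈ F (M [ r ]≔ u) + F (M [ r ]≔ v)
    additive-at M r u v = begin
      F (M [ r ]≔ (λ col → u col + v col))       ≈⟨ cong ([]≔-cong M r (λ col → +-congʳ (*-identityˡ (u col)))) ⟨
      F (M [ r ]≔ (λ col → 1# * u col + v col))  ≈⟨ linear-at M r 1# u v ⟩
      1# * F (M [ r ]≔ u) + F (M [ r ]≔ v)       ≈⟨ +-congʳ (*-identityˡ _) ⟩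
      F (M [ r ]≔ u) + F (M [ r ]≔ v)            ∎

    zero-row : ∀ M r → (∀ col → M r col ≈ 0#) → F M ≈ 0#
    zero-row M r row≈0 = trans (linear r (- 1#) M M M (λ _ _ _ → refl) (λ _ _ _ → refl) row) (cancel (F M))
      where
      cancel : ∀ a → - 1# * a + a ≈ 0#
      cancel a = trans (+-congʳ (-1*x≈-x a)) (-‿inverseˡ a)
      row : ∀ col → M r col ≈ - 1# * M r col + M r col
      row col = trans (row≈0 col) (sym (cancel (M r col)))

    expand-row : ∀ m (M : Matrix n) r (x : Fin m → Carrier) (v : Fin m → Row n) →
                 F (M [ r ]≔ (λ col → sumR m (λ a → x a * v a col))) ≈ sumR m (λ a → x a * F (M [ r ]≔ v a))
    expand-row zero    M r x v = zero-row (M [ r ]≔ _) r ([]≔-at M r _)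
    expand-row (suc m) M r x v = begin
      F (M [ r ]≔ (λ col → x zero * v zero col + rest col)) ≈⟨ linear-at M r (x zero) (v zero) rest ⟩
      x zero * F (M [ r ]≔ v zero) + F (M [ r ]≔ rest)     ≈⟨ +-congˡ (expand-row m M r (x ∘ suc) (v ∘ suc)) ⟩
      sumR (suc m) (λ a → x a * F (M [ r ]≔ v a))          ∎
      where
      rest : Row n
      rest col = sumR m (λ a → x (suc a) * v (suc a) col)

    expand-in-units : ∀ (M : Matrix n) r (v : Row n) → F (M [ r ]≔ v) ≈ sumR n (λ a → v a * F (M [ r ]≔ 𝟙 a))
    expand-in-units M r v = trans (cong ([]≔-cong M r (λ col → sym (sumR-𝟙ʳ col v)))) (expand-row n M r v 𝟙)

    module TwoRows (M : Matrix n) {r s : Fin n} (r≢s : r ≢ s) where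
      B : Row n → Row n → Carrier
      B u w = F ((M [ r ]≔ u) [ s ]≔ w)

      B-flip : ∀ u w → B u w ≈ F ((M [ s ]≔ w) [ r ]≔ u)
      B-flip u w = cong (≗⇒≈ᴹ (updateAt-commutes s r (r≢s ∘ ≡.sym) M))

      B-congʳ : ∀ u {w w′} → (∀ col → w col ≈ w′ col) → B u w ≈ B u w′
      B-congʳ u w≈w′ = cong ([]≔-cong (M [ r ]≔ u) s w≈w′)

      B-additiveˡ : ∀ u u′ w → B (λ col → u col + u′ col) w ≈ B u w + B u′ w
      B-additiveˡ u u′ w =
        trans (B-flip _ w) (trans (additive-at (M [ s ]≔ w) r u u′) (sym (+-cong (B-flip u w) (B-flip u′ w))))

      B-additiveʳ : ∀ u w w′ → B u (λ col → w col + w′ col) ≈ B u w + B u w′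
      B-additiveʳ u = additive-at (M [ r ]≔ u) s

      B-expandˡ : ∀ u w → B u w ≈ sumR n (λ a → u a * B (𝟙 a) w)
      B-expandˡ u w = trans (B-flip u w) (trans (expand-in-units (M [ s ]≔ w) r u)
                        (sumR-cong n (λ a → *-congˡ (sym (B-flip (𝟙 a) w)))))

      B-expandʳ : ∀ u w → B u w ≈ sumR n (λ b → w b * B u (𝟙 b))
      B-expandʳ u = expand-in-units (M [ r ]≔ u) s

      B-antisym : (∀ v → B v v ≈ 0#) → ∀ u w → B u w + B w u ≈ 0#
      B-antisym B-diag u w = begin
        B u w + B w u                                  ≈⟨ +-cong (+-identityˡ _) (+-identityʳ _) ⟨
        (0# + B u w) + (B w u + 0#)                    ≈⟨ +-cong (+-congʳ (B-diag u)) (+-congˡ (B-diag w)) ⟨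
        (B u u + B u w) + (B w u + B w w)              ≈⟨ +-cong (B-additiveʳ u u w) (B-additiveʳ w u w) ⟨
        B u (λ col → u col + w col) + B w (λ col → u col + w col) ≈⟨ B-additiveˡ u w _ ⟨
        B (λ col → u col + w col) (λ col → u col + w col) ≈⟨ B-diag _ ⟩
        0#                                             ∎

      B-self : F M ≈ B (M r) (M s)
      B-self = cong (≗⇒≈ᴹ (≗updateTwice M (M r) (M s) r≢s ≡.refl ≡.refl (λ _ _ _ → ≡.refl)))

      B-transposed : F (M ∘ transpose r s) ≈ B (M s) (M r)
      B-transposed = cong (≗⇒≈ᴹ (≗updateTwice M (M s) (M r) r≢s
        (≡.cong M (transpose-at-first r s)) (≡.cong M (transpose-at-second r s))
        (λ i i≢r i≢s → ≡.cong M (transpose-elsewhere i≢r i≢s))))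

  module AlternatingProperties {n} {F : Matrix n → Carrier}
           (F-multilinear : IsMultilinear n F) (F-alternating : Alternating n F) where
    open MultilinearProperties F-multilinear

    transpose-antisym : ∀ M {r s : Fin n} → r ≢ s → F M + F (M ∘ transpose r s) ≈ 0#
    transpose-antisym M {r} {s} r≢s =
      trans (+-cong B-self B-transposed) (B-antisym B-diag (M r) (M s))
      where
      open TwoRows M r≢s
      B-diag : ∀ v → B v v ≈ 0#
      B-diag v = F-alternating _ r s r≢s (λ col → reflexive (≡.cong-app
                   (≡.trans (updateTwice-first M v v r≢s) (≡.sym (updateTwice-second M v v))) col))

    unitRows : (Fin n → Fin n) → Matrix n
    unitRows f i = 𝟙 (f i)

    FixesBelow : ℕ → (Fin n → Fin n) → Set
    FixesBelow m f = ∀ i → toℕ i ℕ.< m → f i ≡ i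

    fixesBelow-suc : ∀ {m r g} → toℕ r ≡ m → FixesBelow m g → g r ≡ r → FixesBelow (suc m) g
    fixesBelow-suc {r = r} {g} r≡m fixed gr≡r i i<1+m with ℕ.m<1+n⇒m<n∨m≡n i<1+m
    ... | inj₁ i<m = fixed i i<m
    ... | inj₂ i≡m rewrite Fin.toℕ-injective {i = i} {j = r} (≡.trans i≡m (≡.sym r≡m)) = gr≡r

    -- On rows of unit vectors, F is carried to F 𝟙 by transpositions, each of which only flips its sign,
    -- unless two rows coincide; and every matrix is a linear combination of such, row by row.
    module _ (F𝟙≈0 : F 𝟙 ≈ 0#) where

      sort-step : ∀ m (r : Fin n) → toℕ r ≡ m → ∀ f → FixesBelow m f →
                  (∀ g → FixesBelow (suc m) g → F (unitRows g) ≈ 0#) → F (unitRows f) ≈ 0#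
      sort-step m r r≡m f fixed IH with f r Fin.≟ r
      ... | yes fr≡r = IH f (fixesBelow-suc r≡m fixed fr≡r)
      ... | no fr≢r with Fin.any? (λ s → f s Fin.≟ r)
      ...   | yes (s , fs≡r) = begin
        F (unitRows f)                                     ≈⟨ +-identityʳ _ ⟨
        F (unitRows f) + 0#                                ≈⟨ +-congˡ (IH (f ∘ transpose r s) fixed′) ⟨
        F (unitRows f) + F (unitRows (f ∘ transpose r s))  ≈⟨ transpose-antisym (unitRows f) r≢s ⟩
        0#                                                 ∎
        where
        r≢s : r ≢ s
        r≢s r≡s = fr≢r (≡.subst (λ j → f j ≡ r) (≡.sym r≡s) fs≡r)
        fixed′ : FixesBelow (suc m) (f ∘ transpose r s)
        fixed′ = fixesBelow-suc r≡m
          (λ i i<m → ≡.trans (≡.cong f (transpose-elsewhere (i≢r i i<m) (i≢s i i<m))) (fixed i i<m))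
                                    (≡.trans (≡.cong f (transpose-at-first r s)) fs≡r)
          where
          i≢r : ∀ i → toℕ i ℕ.< m → i ≢ r
          i≢r i i<m i≡r = ℕ.<-irrefl (≡.trans (≡.cong toℕ i≡r) r≡m) i<m
          i≢s : ∀ i → toℕ i ℕ.< m → i ≢ s
          i≢s i i<m ≡.refl = r≢s (≡.trans (≡.sym fs≡r) (fixed i i<m))
      ...   | no r∉image with non-surjective⇒collision f r (λ s fs≡r → r∉image (s , fs≡r))
      ...     | i , j , i≢j , fi≡fj = F-alternating (unitRows f) i j i≢j (λ col → reflexive (≡.cong (λ t → 𝟙 t col) fi≡fj))

      vanish-on-unitRows : ∀ k m → m ℕ.+ k ≡ n → ∀ f → FixesBelow m f → F (unitRows f) ≈ 0#
      vanish-on-unitRows zero m m+0≡n f fixed = trans (cong (≗⇒≈ᴹ (λ i → ≡.cong 𝟙 (fixed i (i<m i))))) F𝟙≈0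
        where
        i<m : ∀ i → toℕ i ℕ.< m
        i<m i = ≡.subst (toℕ i ℕ.<_) (≡.trans (≡.sym m+0≡n) (ℕ.+-identityʳ m)) (Fin.toℕ<n i)
      vanish-on-unitRows (suc k) m m+1+k≡n f fixed =
        sort-step m (Fin.fromℕ< m<n) (Fin.toℕ-fromℕ< m<n) f fixed
          (vanish-on-unitRows k (suc m) (≡.trans (≡.sym (ℕ.+-suc m k)) m+1+k≡n))
        where
        m<n : m ℕ.< n
        m<n = ≡.subst (m ℕ.<_) m+1+k≡n (ℕ.m<m+n m ℕ.z<s)

      vanish-from-row : ∀ m → m ℕ.≤ n → ∀ (A : Matrix n) (f : Fin n → Fin n) →
                        (∀ i → m ℕ.≤ toℕ i → ∀ col → A i col ≈ 𝟙 (f i) col) → F A ≈ 0#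
      vanish-from-row zero _ A f A≈ = trans (cong (λ i → A≈ i ℕ.z≤n)) (vanish-on-unitRows n 0 ≡.refl f (λ _ ()))
      vanish-from-row (suc m) m<n A f A≈ = begin
        F A                                      ≈⟨ cong (≗⇒≈ᴹ (λ i → ≡.sym (updateAt-id-local r A ≡.refl i))) ⟩
        F (A [ r ]≔ A r)                         ≈⟨ expand-in-units A r (A r) ⟩
        sumR n (λ a → A r a * F (A [ r ]≔ 𝟙 a))
          ≈⟨ sumR-zero n (λ a → trans (*-congˡ (vanish-from-row m (ℕ.<⇒≤ m<n) _ _ (units a))) (zeroʳ _)) ⟩
        0#                                       ∎
        where
        r : Fin n
        r = Fin.fromℕ< m<n
        units : ∀ a i → m ℕ.≤ toℕ i → ∀ col → (A [ r ]≔ 𝟙 a) i col ≈ 𝟙 ((f [ r ]≔ a) i) col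
        units a i m≤i col with i Fin.≟ r
        ... | yes ≡.refl =
          reflexive (≡.cong-app (≡.trans (updateAt-updates r A) (≡.cong 𝟙 (≡.sym (updateAt-updates r f)))) col)
        ... | no i≢r = begin
          (A [ r ]≔ 𝟙 a) i col    ≡⟨ ≡.cong-app (updateAt-minimal i r A i≢r) col ⟩
          A i col                 ≈⟨ A≈ i (ℕ.≤∧≢⇒< m≤i m≢i) col ⟩
          𝟙 (f i) col             ≡⟨ ≡.cong (λ t → 𝟙 t col) (updateAt-minimal i r f i≢r) ⟨
          𝟙 ((f [ r ]≔ a) i) col  ∎
          where
          m≢i : m ≢ toℕ i
          m≢i m≡i = i≢r (Fin.toℕ-injective (≡.trans (≡.sym m≡i) (≡.sym (Fin.toℕ-fromℕ< m<n))))

      vanish : ∀ A → F A ≈ 0#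
      vanish A = vanish-from-row n ℕ.≤-refl A id (λ i n≤i → ⊥-elim (ℕ.<⇒≱ (Fin.toℕ<n i) n≤i))

  det-multilinear : ∀ n → IsMultilinear n (det n)
  det-multilinear n = record { cong = det-cong n ; linear = det-linear n }

  det-unitRow : ∀ n (M : Matrix (suc n)) a → (∀ col → M zero col ≈ 𝟙 a col) → det (suc n) M ≈ sign a * det n (minor a M)
  det-unitRow n M a row₀ = begin
    det (suc n) M                                     ≈⟨ det-expansion n M ⟩
    sumR (suc n) (λ j → sign j * laplaceTerm n M j)   ≈⟨ sumR-single (suc n) _ a off-a ⟩
    sign a * (M zero a * det n (minor a M))
      ≈⟨ *-congˡ (trans (*-congʳ (trans (row₀ a) (𝟙-diag a))) (*-identityˡ _)) ⟩
    sign a * det n (minor a M)                        ∎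
    where
    off-a : ∀ j → j ≢ a → sign j * laplaceTerm n M j ≈ 0#
    off-a j j≢a = trans (*-congˡ (trans (*-congʳ (trans (row₀ j) (𝟙-offDiag (j≢a ∘ ≡.sym)))) (zeroˡ _))) (zeroʳ _)

  neg*neg : ∀ x y → - x * - y ≈ x * y
  neg*neg x y = trans (sym (-‿distribˡ-* x (- y))) (trans (-‿cong (sym (-‿distribʳ-* x y))) (-‿involutive _))

  sign-punchOut : ∀ {m} {a b : Fin (suc m)} (a≢b : a ≢ b) (b≢a : b ≢ a) →
                  sign a * sign (punchOut a≢b) ≈ - (sign b * sign (punchOut b≢a))
  sign-punchOut {a = zero} {zero} a≢b _ = ⊥-elim (a≢b ≡.refl)
  sign-punchOut {suc m} {zero} {suc b} _ _ =
    trans (*-identityˡ _) (sym (trans (-‿cong (*-identityʳ _)) (-‿involutive _)))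
  sign-punchOut {suc m} {suc a} {zero} _ _ = trans (*-identityʳ _) (-‿cong (sym (*-identityˡ _)))
  sign-punchOut {suc m} {suc a} {suc b} a≢b b≢a = begin
    - sign a * - sign (punchOut (a≢b ∘ ≡.cong suc))       ≈⟨ neg*neg _ _ ⟩
    sign a * sign (punchOut (a≢b ∘ ≡.cong suc))           ≈⟨ sign-punchOut (a≢b ∘ ≡.cong suc) (b≢a ∘ ≡.cong suc) ⟩
    - (sign b * sign (punchOut (b≢a ∘ ≡.cong suc)))       ≈⟨ -‿cong (neg*neg _ _) ⟨
    - (- sign b * - sign (punchOut (b≢a ∘ ≡.cong suc)))   ∎

  -- B(eₐ, e_b) is a signed minor of order n, and deleting columns a and b in either order gives
  -- the same minor with opposite signs; this makes B antisymmetric on unit vectors.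
  module LeadingRows {n} (M : Matrix (suc (suc n))) where
    open MultilinearProperties (det-multilinear (suc (suc n))) using (module TwoRows)
    open TwoRows M {zero} {suc zero} (λ ()) public
    open MultilinearProperties (det-multilinear (suc n)) using (zero-row)

    rows : Fin (suc (suc n)) → Row (suc (suc n)) → Matrix (suc (suc n))
    rows a w = (M [ zero ]≔ 𝟙 a) [ suc zero ]≔ w

    B-unit : ∀ a w → B (𝟙 a) w ≈ sign a * det (suc n) (minor a (rows a w))
    B-unit a w = det-unitRow (suc n) (rows a w) a
      (λ col → reflexive (≡.cong-app (updateTwice-first M {zero} {suc zero} (𝟙 a) w (λ ())) col))

    minor-row₀ : ∀ a w col → minor a (rows a w) zero col ≈ w (punchIn a col)
    minor-row₀ a w col = reflexive (≡.cong-app (updateTwice-second M {zero} {suc zero} (𝟙 a) w) (punchIn a col))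

    B-unit-diag : ∀ a → B (𝟙 a) (𝟙 a) ≈ 0#
    B-unit-diag a = trans (B-unit a (𝟙 a)) (trans (*-congˡ (zero-row (minor a (rows a (𝟙 a))) zero row₀≈0)) (zeroʳ _))
      where
      row₀≈0 : ∀ col → minor a (rows a (𝟙 a)) zero col ≈ 0#
      row₀≈0 col = trans (minor-row₀ a (𝟙 a) col) (𝟙-offDiag (Fin.punchInᵢ≢i a col ∘ ≡.sym))

    minor₂ : ∀ {a b} → a ≢ b → Matrix n
    minor₂ {a} a≢b r col = M (suc (suc r)) (punchIn a (punchIn (punchOut a≢b) col))

    B-units : ∀ {a b} (a≢b : a ≢ b) → B (𝟙 a) (𝟙 b) ≈ sign a * (sign (punchOut a≢b) * det n (minor₂ a≢b))
    B-units {a} {b} a≢b = trans (B-unit a (𝟙 b)) (*-congˡ (trans (det-unitRow n (minor a (rows a (𝟙 b))) (punchOut a≢b) row₀)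
      (*-congˡ (det-cong n (λ r col → reflexive (≡.cong-app
        (updateTwice-elsewhere M {zero} {suc zero} (𝟙 a) (𝟙 b) {suc (suc r)} (λ ()) (λ ())) _))))))
      where
      row₀ : ∀ col → minor a (rows a (𝟙 b)) zero col ≈ 𝟙 (punchOut a≢b) col
      row₀ col = trans (minor-row₀ a (𝟙 b) col) (𝟙-cong
        (λ b≡a+col → Fin.punchIn-injective a _ _ (≡.trans (Fin.punchIn-punchOut a≢b) b≡a+col))
        (λ po≡col → ≡.trans (≡.sym (Fin.punchIn-punchOut a≢b)) (≡.cong (punchIn a) po≡col)))

    B-units-antisym : ∀ {a b} → a ≢ b → B (𝟙 a) (𝟙 b) + B (𝟙 b) (𝟙 a) ≈ 0#
    B-units-antisym {a} {b} a≢b = begin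
      B (𝟙 a) (𝟙 b) + B (𝟙 b) (𝟙 a)                                        ≈⟨ +-cong (B-units a≢b) (B-units b≢a) ⟩
      sign a * (σ₁ * det n (minor₂ a≢b)) + sign b * (σ₂ * det n (minor₂ b≢a))
        ≈⟨ +-congˡ (*-congˡ (*-congˡ (det-cong n same-minor))) ⟩
      sign a * (σ₁ * D) + sign b * (σ₂ * D)
        ≈⟨ solve 5 (λ x p y q d → x :* (p :* d) :+ y :* (q :* d) := (x :* p :+ y :* q) :* d) refl (sign a) σ₁ (sign b) σ₂ D ⟩
      (sign a * σ₁ + sign b * σ₂) * D            ≈⟨ *-congʳ (trans (+-congʳ (sign-punchOut a≢b b≢a)) (-‿inverseˡ _)) ⟩
      0# * D                                     ≈⟨ zeroˡ D ⟩
      0#                                         ∎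
      where
      b≢a : b ≢ a
      b≢a = a≢b ∘ ≡.sym
      σ₁ σ₂ D : Carrier
      σ₁ = sign (punchOut a≢b)
      σ₂ = sign (punchOut b≢a)
      D = det n (minor₂ a≢b)
      same-minor : minor₂ b≢a ≈ᴹ minor₂ a≢b
      same-minor r col = reflexive (≡.cong (M (suc (suc r))) (≡.sym (punchIn-punchIn-comm a≢b b≢a col)))

  det-rows01 : ∀ n (M : Matrix (suc (suc n))) → (∀ col → M zero col ≈ M (suc zero) col) →
               det (suc (suc n)) M ≈ 0#
  det-rows01 n M row₀≈row₁ = begin
    det N M                                                     ≈⟨ B-self ⟩
    B u (M (suc zero))                                          ≈⟨ B-congʳ u (λ col → sym (row₀≈row₁ col)) ⟩
    B u u                                                       ≈⟨ B-expandˡ u u ⟩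
    sumR N (λ a → u a * B (𝟙 a) u)                             ≈⟨ sumR-cong N expand-second ⟩
    sumR N (λ a → sumR N (λ b → u a * (u b * B (𝟙 a) (𝟙 b))))  ≈⟨ sumR-antisymmetric N _ diagonal off-diagonal ⟩
    0#                                                          ∎
    where
    N : ℕ
    N = suc (suc n)
    u : Row N
    u = M zero
    open LeadingRows M

    expand-second : ∀ a → u a * B (𝟙 a) u ≈ sumR N (λ b → u a * (u b * B (𝟙 a) (𝟙 b)))
    expand-second a = trans (*-congˡ (B-expandʳ (𝟙 a) u)) (*-distribˡ-sumR N (u a) (λ b → u b * B (𝟙 a) (𝟙 b)))

    diagonal : ∀ a → u a * (u a * B (𝟙 a) (𝟙 a)) ≈ 0#
    diagonal a = trans (*-congˡ (trans (*-congˡ (B-unit-diag a)) (zeroʳ _))) (zeroʳ _)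

    off-diagonal : ∀ a b → a ≢ b → u a * (u b * B (𝟙 a) (𝟙 b)) + u b * (u a * B (𝟙 b) (𝟙 a)) ≈ 0#
    off-diagonal a b a≢b = trans
      (solve 4 (λ x y p q → x :* (y :* p) :+ y :* (x :* q) := (x :* y) :* (p :+ q)) refl (u a) (u b) _ _)
      (trans (*-congˡ (B-units-antisym a≢b)) (zeroʳ _))

  -- Swapping rows 1 and s + 2 transposes two rows of every minor.
  det-swap-lower-rows : ∀ n → Alternating (suc n) (det (suc n)) → ∀ (M : Matrix (suc (suc n))) s →
                        det (suc (suc n)) (M ∘ transpose (suc zero) (suc (suc s))) ≈ - det (suc (suc n)) M
  det-swap-lower-rows n det-alternating M s = begin
    det N M′                                              ≈⟨ det-expansion (suc n) M′ ⟩
    sumR N (λ j → sign j * laplaceTerm (suc n) M′ j)       ≈⟨ sumR-cong N term ⟩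
    sumR N (λ j → - (sign j * laplaceTerm (suc n) M j))    ≈⟨ -‿distrib-sumR N (λ j → sign j * laplaceTerm (suc n) M j) ⟨
    - sumR N (λ j → sign j * laplaceTerm (suc n) M j)      ≈⟨ -‿cong (det-expansion (suc n) M) ⟨
    - det N M                                             ∎
    where
    N : ℕ
    N = suc (suc n)
    M′ : Matrix N
    M′ = M ∘ transpose (suc zero) (suc (suc s))
    open AlternatingProperties (det-multilinear (suc n)) det-alternating using (transpose-antisym)

    row₀ : M′ zero ≡ M zero
    row₀ = ≡.cong M (transpose-elsewhere {r = suc zero} {suc (suc s)} {zero} (λ ()) (λ ()))

    minor-M′ : ∀ j → det (suc n) (minor j M′) ≈ - det (suc n) (minor j M)
    minor-M′ j = trans
      (det-cong (suc n) (≗⇒≈ᴹ (λ r → ≡.cong (λ i col → M i (punchIn j col)) (transpose-suc zero (suc s) r))))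
                       (+-inverseʳ-unique _ _ (transpose-antisym (minor j M) {zero} {suc s} (λ ())))

    term : ∀ j → sign j * laplaceTerm (suc n) M′ j ≈ - (sign j * laplaceTerm (suc n) M j)
    term j = begin
      sign j * (M′ zero j * det (suc n) (minor j M′))    ≈⟨ *-congˡ (*-cong (reflexive (≡.cong-app row₀ j)) (minor-M′ j)) ⟩
      sign j * (M zero j * - det (suc n) (minor j M))    ≈⟨ *-congˡ (-‿distribʳ-* _ _) ⟨
      sign j * - (M zero j * det (suc n) (minor j M))    ≈⟨ -‿distribʳ-* _ _ ⟨
      - (sign j * (M zero j * det (suc n) (minor j M)))  ∎

  det-first-row-repeated : ∀ n → Alternating (suc n) (det (suc n)) → ∀ (M : Matrix (suc (suc n))) s →
                           (∀ col → M zero col ≈ M (suc s) col) → det (suc (suc n)) M ≈ 0#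
  det-first-row-repeated n _ M zero rows = det-rows01 n M rows
  det-first-row-repeated n det-alternating M (suc s) rows = begin
    det N M       ≈⟨ -‿involutive _ ⟨
    - - det N M   ≈⟨ -‿cong (det-swap-lower-rows n det-alternating M s) ⟨
    - det N M′    ≈⟨ -‿cong (det-rows01 n M′ rows′) ⟩
    - 0#          ≈⟨ -0#≈0# ⟩
    0#            ∎
    where
    N : ℕ
    N = suc (suc n)
    M′ : Matrix N
    M′ = M ∘ transpose (suc zero) (suc (suc s))
    rows′ : ∀ col → M′ zero col ≈ M′ (suc zero) col
    rows′ col = begin
      M (transpose (suc zero) (suc (suc s)) zero) col
        ≡⟨ ≡.cong (λ i → M i col) (transpose-elsewhere {r = suc zero} {suc (suc s)} {zero} (λ ()) (λ ())) ⟩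
      M zero col                                             ≈⟨ rows col ⟩
      M (suc (suc s)) col
        ≡⟨ ≡.cong (λ i → M i col) (transpose-at-first (suc zero) (suc (suc s))) ⟨
      M (transpose (suc zero) (suc (suc s)) (suc zero)) col  ∎

  det-alternating : ∀ n → Alternating n (det n)
  det-alternating (suc n) M zero    zero    0≢0 _    = ⊥-elim (0≢0 ≡.refl)
  det-alternating (suc (suc n)) M zero (suc s) _ rows = det-first-row-repeated n (det-alternating (suc n)) M s rows
  det-alternating (suc (suc n)) M (suc r) zero _ rows =
    det-first-row-repeated n (det-alternating (suc n)) M r (λ col → sym (rows col))
  det-alternating (suc n) M (suc r) (suc s) r≢s rows =
    trans (det-expansion n M) (sumR-zero (suc n) {λ j → sign j * laplaceTerm n M j} λ j →
      trans (*-congˡ (trans (*-congˡ (det-alternating n (minor j M) r s (r≢s ∘ ≡.cong suc) (rows ∘ punchIn j))) (zeroʳ _)))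
            (zeroʳ _))

  det-𝟙 : ∀ n → det n 𝟙 ≈ 1#
  det-𝟙 zero    = refl
  det-𝟙 (suc n) = begin
    det (suc n) 𝟙                            ≈⟨ det-unitRow n 𝟙 zero (λ _ → refl) ⟩
    1# * det n (λ r c → 𝟙 (suc r) (suc c))  ≈⟨ *-identityˡ _ ⟩
    det n (λ r c → 𝟙 (suc r) (suc c))       ≈⟨ det-cong n (λ r c → 𝟙-cong Fin.suc-injective (≡.cong suc)) ⟩
    det n 𝟙                                  ≈⟨ det-𝟙 n ⟩
    1#                                       ∎

  module ProductDefect {n} (B : Matrix n) where
    defect : Matrix n → Carrier
    defect X = det n (X ⊗ B) - det n X * det n B

    ⊗B-agree : ∀ {r} {X Y : Matrix n} → RowsAgreeOff r X Y → RowsAgreeOff r (X ⊗ B) (Y ⊗ B)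
    ⊗B-agree X≈Y i i≢r col = sumR-cong n (λ t → *-congʳ (X≈Y i i≢r t))

    defect-linear : RowLinear n defect
    defect-linear r x M U W M≈U M≈W rowᵣ = begin
      det n (M ⊗ B) - det n M * det n B
        ≈⟨ +-cong (det-linear n r x _ _ _ (⊗B-agree M≈U) (⊗B-agree M≈W) row⊗B)
                  (-‿cong (*-congʳ (det-linear n r x M U W M≈U M≈W rowᵣ))) ⟩
      (x * det n (U ⊗ B) + det n (W ⊗ B)) - (x * det n U + det n W) * det n B
        ≈⟨ solve 6 (λ x a b c d e → (x :* a :+ b) :+ :- ((x :* c :+ d) :* e)
                                  := x :* (a :+ :- (c :* e)) :+ (b :+ :- (d :* e)))
                   refl x (det n (U ⊗ B)) (det n (W ⊗ B)) (det n U) (det n W) (det n B) ⟩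
      x * defect U + defect W ∎
      where
      row⊗B : ∀ col → (M ⊗ B) r col ≈ x * (U ⊗ B) r col + (W ⊗ B) r col
      row⊗B col = begin
        sumR n (λ t → M r t * B t col)                            ≈⟨ sumR-cong n (λ t → *-congʳ (rowᵣ t)) ⟩
        sumR n (λ t → (x * U r t + W r t) * B t col)
          ≈⟨ sumR-cong n (λ t → solve 4 (λ x u w b → (x :* u :+ w) :* b := x :* (u :* b) :+ w :* b)
                                         refl x (U r t) (W r t) (B t col)) ⟩
        sumR n (λ t → x * (U r t * B t col) + W r t * B t col)   ≈⟨ sumR-linear n x _ _ ⟩
        x * (U ⊗ B) r col + (W ⊗ B) r col                        ∎

    defect-multilinear : IsMultilinear n defect
    defect-multilinear = record
      { cong   = λ X≈Y → +-cong (det-cong n (⊗-cong X≈Y ≈ᴹ-refl)) (-‿cong (*-congʳ (det-cong n X≈Y)))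
      ; linear = defect-linear
      }

    defect-alternating : Alternating n defect
    defect-alternating X r s r≢s rows = begin
      det n (X ⊗ B) - det n X * det n B
        ≈⟨ +-cong (det-alternating n (X ⊗ B) r s r≢s (λ col → sumR-cong n (λ t → *-congʳ (rows t))))
                  (-‿cong (*-congʳ (det-alternating n X r s r≢s rows))) ⟩
      0# - 0# * det n B                  ≈⟨ +-congˡ (-‿cong (zeroˡ _)) ⟩
      0# - 0#                            ≈⟨ -‿inverseʳ 0# ⟩
      0#                                 ∎

    defect-𝟙 : defect 𝟙 ≈ 0#
    defect-𝟙 = begin
      det n (𝟙 ⊗ B) - det n 𝟙 * det n B
        ≈⟨ +-cong (det-cong n (⊗-identityˡ B)) (-‿cong (trans (*-congʳ (det-𝟙 n)) (*-identityˡ _))) ⟩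
      det n B - det n B                  ≈⟨ -‿inverseʳ _ ⟩
      0#                                 ∎

  det-⊗ : ∀ n (A B : Matrix n) → det n (A ⊗ B) ≈ det n A * det n B
  det-⊗ n A B = x∙y⁻¹≈ε⇒x≈y _ _ (vanish defect-𝟙 A)
    where
    open ProductDefect B
    open AlternatingProperties defect-multilinear defect-alternating using (vanish)

  det-similar : ∀ n (T T′ M : Matrix n) → (T ⊗ T′) ≈ᴹ 𝟙 → det n ((T ⊗ M) ⊗ T′) ≈ det n M
  det-similar n T T′ M TT′≈𝟙 = begin
    det n ((T ⊗ M) ⊗ T′)              ≈⟨ trans (det-⊗ n _ _) (*-congʳ (det-⊗ n _ _)) ⟩
    (det n T * det n M) * det n T′
      ≈⟨ solve 3 (λ a b c → (a :* b) :* c := b :* (a :* c)) refl (det n T) (det n M) (det n T′) ⟩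
    det n M * (det n T * det n T′)    ≈⟨ *-congˡ (det-⊗ n T T′) ⟨
    det n M * det n (T ⊗ T′)          ≈⟨ *-congˡ (trans (det-cong n TT′≈𝟙) (det-𝟙 n)) ⟩
    det n M * 1#                      ≈⟨ *-identityʳ _ ⟩
    det n M                           ∎

module Polynomials {c ℓ : Level} (R : CommutativeRing c ℓ) where
  open CommutativeRing R hiding (zero)
  open Mat R using (Poly; padd; pneg; pmul; _≈ₚ_)
  open Algebra.Properties.CommutativeSemigroup +-commutativeSemigroup using (interchange)
  open Algebra.Properties.Ring ring using (-0#≈0#)
  open SetoidReasoning setoid

  coeff : Poly → ℕ → Carrier
  coeff []      k       = 0#
  coeff (a ∷ p) zero    = a
  coeff (a ∷ p) (suc k) = coeff p k

  infix 4 _≋_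
  record _≋_ (p q : Poly) : Set ℓ where
    constructor coeffwise
    field at : ∀ k → coeff p k ≈ coeff q k
  open _≋_

  ≋-isEquivalence : IsEquivalence _≋_
  ≋-isEquivalence = record
    { refl  = coeffwise λ k → refl
    ; sym   = λ p≋q → coeffwise λ k → sym (at p≋q k)
    ; trans = λ p≋q q≋r → coeffwise λ k → trans (at p≋q k) (at q≋r k)
    }
  open IsEquivalence ≋-isEquivalence using () renaming (refl to ≋-refl; sym to ≋-sym; trans to ≋-trans)

  ≋⇒≈ₚ : ∀ {p q} → p ≋ q → p ≈ₚ q
  ≋⇒≈ₚ {[]}    {[]}    p≋q = tt
  ≋⇒≈ₚ {[]}    {b ∷ q} p≋q = sym (at p≋q zero) , ≋⇒≈ₚ (coeffwise (at p≋q ∘ suc))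
  ≋⇒≈ₚ {a ∷ p} {[]}    p≋q = at p≋q zero , ≋⇒≈ₚ (coeffwise (at p≋q ∘ suc))
  ≋⇒≈ₚ {a ∷ p} {b ∷ q} p≋q = at p≋q zero , ≋⇒≈ₚ (coeffwise (at p≋q ∘ suc))

  ∷-cong : ∀ {a b p q} → a ≈ b → p ≋ q → (a ∷ p) ≋ (b ∷ q)
  ∷-cong a≈b p≋q = coeffwise λ { zero → a≈b ; (suc k) → at p≋q k }

  coeff-padd : ∀ p q k → coeff (padd p q) k ≈ coeff p k + coeff q k
  coeff-padd []      q       k       = sym (+-identityˡ _)
  coeff-padd (a ∷ p) []      k       = sym (+-identityʳ _)
  coeff-padd (a ∷ p) (b ∷ q) zero    = refl
  coeff-padd (a ∷ p) (b ∷ q) (suc k) = coeff-padd p q k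

  coeff-pneg : ∀ p k → coeff (pneg p) k ≈ - coeff p k
  coeff-pneg []      k       = sym -0#≈0#
  coeff-pneg (a ∷ p) zero    = refl
  coeff-pneg (a ∷ p) (suc k) = coeff-pneg p k

  coeff-scale : ∀ a p k → coeff (map (a *_) p) k ≈ a * coeff p k
  coeff-scale a []      k       = sym (zeroʳ a)
  coeff-scale a (b ∷ p) zero    = refl
  coeff-scale a (b ∷ p) (suc k) = coeff-scale a p k

  padd-cong : ∀ {p p′ q q′} → p ≋ p′ → q ≋ q′ → padd p q ≋ padd p′ q′
  padd-cong {p} {p′} {q} {q′} p≋p′ q≋q′ = coeffwise λ k →
    trans (coeff-padd p q k) (trans (+-cong (at p≋p′ k) (at q≋q′ k)) (sym (coeff-padd p′ q′ k)))

  pneg-cong : ∀ {p p′} → p ≋ p′ → pneg p ≋ pneg p′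
  pneg-cong {p} {p′} p≋p′ = coeffwise λ k → trans (coeff-pneg p k) (trans (-‿cong (at p≋p′ k)) (sym (coeff-pneg p′ k)))

  scale-cong : ∀ {a b p q} → a ≈ b → p ≋ q → map (a *_) p ≋ map (b *_) q
  scale-cong {a} {b} {p} {q} a≈b p≋q = coeffwise λ k →
    trans (coeff-scale a p k) (trans (*-cong a≈b (at p≋q k)) (sym (coeff-scale b q k)))

  padd-assoc : ∀ p q r → padd (padd p q) r ≋ padd p (padd q r)
  padd-assoc p q r = coeffwise λ k → begin
    coeff (padd (padd p q) r) k          ≈⟨ trans (coeff-padd (padd p q) r k) (+-congʳ (coeff-padd p q k)) ⟩
    (coeff p k + coeff q k) + coeff r k  ≈⟨ +-assoc _ _ _ ⟩
    coeff p k + (coeff q k + coeff r k)  ≈⟨ trans (coeff-padd p (padd q r) k) (+-congˡ (coeff-padd q r k)) ⟨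
    coeff (padd p (padd q r)) k          ∎

  padd-comm : ∀ p q → padd p q ≋ padd q p
  padd-comm p q = coeffwise λ k → trans (coeff-padd p q k) (trans (+-comm _ _) (sym (coeff-padd q p k)))

  padd-interchange : ∀ p q r s → padd (padd p q) (padd r s) ≋ padd (padd p r) (padd q s)
  padd-interchange p q r s = coeffwise λ k → begin
    coeff (padd (padd p q) (padd r s)) k
      ≈⟨ trans (coeff-padd (padd p q) (padd r s) k) (+-cong (coeff-padd p q k) (coeff-padd r s k)) ⟩
    (coeff p k + coeff q k) + (coeff r k + coeff s k)  ≈⟨ interchange _ _ _ _ ⟩
    (coeff p k + coeff r k) + (coeff q k + coeff s k)
      ≈⟨ trans (coeff-padd (padd p r) (padd q s) k) (+-cong (coeff-padd p r k) (coeff-padd q s k)) ⟨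
    coeff (padd (padd p r) (padd q s)) k               ∎

  padd-identityˡ : ∀ p → padd [] p ≋ p
  padd-identityˡ p = ≋-refl

  padd-identityʳ : ∀ p → padd p [] ≋ p
  padd-identityʳ p = coeffwise λ k → trans (coeff-padd p [] k) (+-identityʳ _)

  pneg-inverseˡ : ∀ p → padd (pneg p) p ≋ []
  pneg-inverseˡ p = coeffwise λ k → trans (coeff-padd (pneg p) p k) (trans (+-congʳ (coeff-pneg p k)) (-‿inverseˡ _))

  pneg-inverseʳ : ∀ p → padd p (pneg p) ≋ []
  pneg-inverseʳ p = coeffwise λ k → trans (coeff-padd p (pneg p) k) (trans (+-congˡ (coeff-pneg p k)) (-‿inverseʳ _))

  scale-distribˡ : ∀ a p q → map (a *_) (padd p q) ≋ padd (map (a *_) p) (map (a *_) q)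
  scale-distribˡ a p q = coeffwise λ k → begin
    coeff (map (a *_) (padd p q)) k               ≈⟨ trans (coeff-scale a (padd p q) k) (*-congˡ (coeff-padd p q k)) ⟩
    a * (coeff p k + coeff q k)                   ≈⟨ distribˡ a _ _ ⟩
    a * coeff p k + a * coeff q k
      ≈⟨ trans (coeff-padd (map (a *_) p) (map (a *_) q) k) (+-cong (coeff-scale a p k) (coeff-scale a q k)) ⟨
    coeff (padd (map (a *_) p) (map (a *_) q)) k  ∎

  scale-distribʳ : ∀ a b p → map ((a + b) *_) p ≋ padd (map (a *_) p) (map (b *_) p)
  scale-distribʳ a b p = coeffwise λ k → begin
    coeff (map ((a + b) *_) p) k                  ≈⟨ coeff-scale (a + b) p k ⟩
    (a + b) * coeff p k                           ≈⟨ distribʳ _ a b ⟩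
    a * coeff p k + b * coeff p k
      ≈⟨ trans (coeff-padd (map (a *_) p) (map (b *_) p) k) (+-cong (coeff-scale a p k) (coeff-scale b p k)) ⟨
    coeff (padd (map (a *_) p) (map (b *_) p)) k  ∎

  shift-padd : ∀ p q → (0# ∷ padd p q) ≋ padd (0# ∷ p) (0# ∷ q)
  shift-padd p q = ∷-cong (sym (+-identityʳ 0#)) ≋-refl

  pmul-congʳ : ∀ p {q q′} → q ≋ q′ → pmul p q ≋ pmul p q′
  pmul-congʳ []      q≋q′ = ≋-refl
  pmul-congʳ (a ∷ p) q≋q′ = padd-cong (scale-cong refl q≋q′) (∷-cong refl (pmul-congʳ p q≋q′))

  pmul-zeroʳ : ∀ p → pmul p [] ≋ []
  pmul-zeroʳ []      = ≋-refl
  pmul-zeroʳ (a ∷ p) = coeffwise λ { zero → refl ; (suc k) → at (pmul-zeroʳ p) k }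

  pmul-distribˡ : ∀ p q r → pmul p (padd q r) ≋ padd (pmul p q) (pmul p r)
  pmul-distribˡ []      q r = ≋-refl
  pmul-distribˡ (a ∷ p) q r =
    ≋-trans (padd-cong (scale-distribˡ a q r)
                       (≋-trans (∷-cong refl (pmul-distribˡ p q r)) (shift-padd (pmul p q) (pmul p r))))
            (padd-interchange (map (a *_) q) (map (a *_) r) (0# ∷ pmul p q) (0# ∷ pmul p r))

  pmul-distribʳ : ∀ p q r → pmul (padd p q) r ≋ padd (pmul p r) (pmul q r)
  pmul-distribʳ []      q       r = ≋-refl
  pmul-distribʳ (a ∷ p) []      r = ≋-sym (padd-identityʳ _)
  pmul-distribʳ (a ∷ p) (b ∷ q) r =
    ≋-trans (padd-cong (scale-distribʳ a b r)
                       (≋-trans (∷-cong refl (pmul-distribʳ p q r)) (shift-padd (pmul p r) (pmul q r))))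
            (padd-interchange (map (a *_) r) (map (b *_) r) (0# ∷ pmul p r) (0# ∷ pmul q r))

  pmul-∷ʳ : ∀ p b q → pmul p (b ∷ q) ≋ padd (map (_* b) p) (0# ∷ pmul p q)
  pmul-∷ʳ []      b q = coeffwise λ { zero → refl ; (suc k) → refl }
  pmul-∷ʳ (a ∷ p) b q = ∷-cong refl
    (≋-trans (padd-cong ≋-refl (pmul-∷ʳ p b q))
    (≋-trans (≋-sym (padd-assoc (map (a *_) q) (map (_* b) p) (0# ∷ pmul p q)))
    (≋-trans (padd-cong (padd-comm (map (a *_) q) (map (_* b) p)) ≋-refl)
             (padd-assoc (map (_* b) p) (map (a *_) q) (0# ∷ pmul p q)))))

  scaleʳ≋scaleˡ : ∀ b p → map (_* b) p ≋ map (b *_) p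
  scaleʳ≋scaleˡ b []      = ≋-refl
  scaleʳ≋scaleˡ b (a ∷ p) = ∷-cong (*-comm a b) (scaleʳ≋scaleˡ b p)

  pmul-comm : ∀ p q → pmul p q ≋ pmul q p
  pmul-comm p []      = pmul-zeroʳ p
  pmul-comm p (b ∷ q) = ≋-trans (pmul-∷ʳ p b q) (padd-cong (scaleʳ≋scaleˡ b p) (∷-cong refl (pmul-comm p q)))

  pmul-congˡ : ∀ {p p′} q → p ≋ p′ → pmul p q ≋ pmul p′ q
  pmul-congˡ {p} {p′} q p≋p′ = ≋-trans (pmul-comm p q) (≋-trans (pmul-congʳ q p≋p′) (pmul-comm q p′))

  pmul-scale : ∀ a q r → pmul (map (a *_) q) r ≋ map (a *_) (pmul q r)
  pmul-scale a []      r = ≋-refl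
  pmul-scale a (b ∷ q) r =
    ≋-trans (padd-cong scale-scale (∷-cong (sym (zeroʳ a)) (pmul-scale a q r)))
            (≋-sym (scale-distribˡ a (map (b *_) r) (0# ∷ pmul q r)))
    where
    scale-scale : map ((a * b) *_) r ≋ map (a *_) (map (b *_) r)
    scale-scale = coeffwise λ k → begin
      coeff (map ((a * b) *_) r) k        ≈⟨ coeff-scale (a * b) r k ⟩
      (a * b) * coeff r k                 ≈⟨ *-assoc a b _ ⟩
      a * (b * coeff r k)                 ≈⟨ trans (coeff-scale a (map (b *_) r) k) (*-congˡ (coeff-scale b r k)) ⟨
      coeff (map (a *_) (map (b *_) r)) k ∎

  pmul-shift : ∀ p r → pmul (0# ∷ p) r ≋ (0# ∷ pmul p r)
  pmul-shift p r = coeffwise λ k → begin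
    coeff (padd (map (0# *_) r) (0# ∷ pmul p r)) k       ≈⟨ coeff-padd (map (0# *_) r) (0# ∷ pmul p r) k ⟩
    coeff (map (0# *_) r) k + coeff (0# ∷ pmul p r) k    ≈⟨ +-congʳ (trans (coeff-scale 0# r k) (zeroˡ _)) ⟩
    0# + coeff (0# ∷ pmul p r) k                         ≈⟨ +-identityˡ _ ⟩
    coeff (0# ∷ pmul p r) k                              ∎

  pmul-assoc : ∀ p q r → pmul (pmul p q) r ≋ pmul p (pmul q r)
  pmul-assoc []      q r = ≋-refl
  pmul-assoc (a ∷ p) q r =
    ≋-trans (pmul-distribʳ (map (a *_) q) (0# ∷ pmul p q) r)
            (padd-cong (pmul-scale a q r) (≋-trans (pmul-shift (pmul p q) r) (∷-cong refl (pmul-assoc p q r))))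

  pmul-identityˡ : ∀ p → pmul (1# ∷ []) p ≋ p
  pmul-identityˡ p = coeffwise λ k → begin
    coeff (padd (map (1# *_) p) (0# ∷ [])) k     ≈⟨ coeff-padd (map (1# *_) p) (0# ∷ []) k ⟩
    coeff (map (1# *_) p) k + coeff (0# ∷ []) k  ≈⟨ +-cong (trans (coeff-scale 1# p k) (*-identityˡ _)) (constant-zero k) ⟩
    coeff p k + 0#                               ≈⟨ +-identityʳ _ ⟩
    coeff p k                                    ∎
    where
    constant-zero : ∀ k → coeff (0# ∷ []) k ≈ 0#
    constant-zero zero    = refl
    constant-zero (suc k) = refl

  polynomialRing : CommutativeRing c ℓ
  polynomialRing = record
    { Carrier = Poly ; _≈_ = _≋_ ; _+_ = padd ; _*_ = pmul ; -_ = pneg ; 0# = [] ; 1# = 1# ∷ []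
    ; isCommutativeRing = record
      { isRing = record
        { +-isAbelianGroup = record
          { isGroup = record
            { isMonoid = record
              { isSemigroup = record
                { isMagma = record { isEquivalence = ≋-isEquivalence ; ∙-cong = padd-cong }
                ; assoc   = padd-assoc }
              ; identity = padd-identityˡ , padd-identityʳ }
            ; inverse = pneg-inverseˡ , pneg-inverseʳ
            ; ⁻¹-cong = pneg-cong }
          ; comm = padd-comm }
        ; *-cong     = λ {p} {p′} {q} {q′} p≋p′ q≋q′ → ≋-trans (pmul-congˡ q p≋p′) (pmul-congʳ p′ q≋q′)
        ; *-assoc    = pmul-assoc
        ; *-identity = pmul-identityˡ , (λ p → ≋-trans (pmul-comm p (1# ∷ [])) (pmul-identityˡ p))
        ; distrib    = pmul-distribˡ , (λ p q r → pmul-distribʳ q r p) }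
      ; *-comm = pmul-comm } }

module CharacteristicPolynomial {c ℓ : Level} (R : CommutativeRing c ℓ) where
  open CommutativeRing R hiding (zero)
  open Mat R
  open Polynomials R using (polynomialRing; ∷-cong; coeffwise; ≋⇒≈ₚ)
  module P = CommutativeRing polynomialRing
  module PMat = Mat polynomialRing
  module PSums = FiniteSums polynomialRing
  open Det padd pmul pneg [] (1# ∷ []) using (det)
  open Determinant polynomialRing using (det-cong; det-similar)
  open MatrixAlgebra polynomialRing using (_·𝟙-_; conjugate-·𝟙-)
  open SetoidReasoning P.setoid

  constant : Carrier → Poly
  constant a = a ∷ []

  constants : ∀ {n} → Matrix n → PMat.Matrix n
  constants M i j = constant (M i j)

  constant-cong : ∀ {a b} → a ≈ b → constant a P.≈ constant b
  constant-cong a≈b = ∷-cong a≈b P.refl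

  constant-sumR : ∀ n (f : Fin n → Carrier) → constant (sumR n f) P.≈ PMat.sumR n (constant ∘ f)
  constant-sumR zero    f = coeffwise λ { zero → refl ; (suc k) → refl }
  constant-sumR (suc n) f = P.+-congˡ (constant-sumR n (f ∘ suc))

  constant-* : ∀ a b → constant (a * b) P.≈ constant a P.* constant b
  constant-* a b = ∷-cong (sym (+-identityʳ _)) P.refl

  constants-⊗ : ∀ {n} (A B : Matrix n) → constants (A ⊗ B) PMat.≈ᴹ (constants A PMat.⊗ constants B)
  constants-⊗ {n} A B i j =
    P.trans (constant-sumR n (λ t → A i t * B t j)) (PSums.sumR-cong n (λ t → constant-* (A i t) (B t j)))

  constants-𝟙 : ∀ {n} → constants (𝟙 {n}) PMat.≈ᴹ PMat.𝟙
  constants-𝟙 i j with i Fin.≟ j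
  ... | yes _ = P.refl
  ... | no _  = coeffwise λ { zero → refl ; (suc k) → refl }

  X : Poly
  X = 0# ∷ 1# ∷ []

  charPoly-matrix≈ : ∀ {n} (M : Matrix n) →
    (λ i j → padd (if ⌊ i Fin.≟ j ⌋ then X else []) (pneg (M i j ∷ []))) PMat.≈ᴹ (X ·𝟙- constants M)
  charPoly-matrix≈ M i j with i Fin.≟ j
  ... | yes _ = P.+-congʳ {pneg (M i j ∷ [])} (P.sym (P.*-identityʳ X))
  ... | no _  = P.+-congʳ {pneg (M i j ∷ [])} (P.sym (P.zeroʳ X))

  cospectral-similar : ∀ {n} (T T′ M₁ M₂ : Matrix n) → (T ⊗ T′) ≈ᴹ 𝟙 → ((T ⊗ M₁) ⊗ T′) ≈ᴹ M₂ →
                       Cospectral M₁ M₂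
  cospectral-similar {n} T T′ M₁ M₂ TT′≈𝟙 TM₁T′≈M₂ = ≋⇒≈ₚ (begin
    charPoly M₁                                                 ≈⟨ det-cong n (charPoly-matrix≈ M₁) ⟩
    det n (X ·𝟙- constants M₁)                                  ≈⟨ det-similar n (constants T) (constants T′) _ TT′≈𝟙ₚ ⟨
    det n ((constants T PMat.⊗ (X ·𝟙- constants M₁)) PMat.⊗ constants T′)
      ≈⟨ det-cong n (conjugate-·𝟙- (constants T) (constants T′) (constants M₁) X TT′≈𝟙ₚ) ⟩
    det n (X ·𝟙- ((constants T PMat.⊗ constants M₁) PMat.⊗ constants T′))
      ≈⟨ det-cong n (λ i j → P.+-congˡ (P.-‿cong (TM₁T′≈M₂ₚ i j))) ⟩
    det n (X ·𝟙- constants M₂)                                  ≈⟨ det-cong n (charPoly-matrix≈ M₂) ⟨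
    charPoly M₂                                                 ∎)
    where
    TT′≈𝟙ₚ : (constants T PMat.⊗ constants T′) PMat.≈ᴹ PMat.𝟙
    TT′≈𝟙ₚ i j = P.trans (P.sym (constants-⊗ T T′ i j)) (P.trans (constant-cong (TT′≈𝟙 i j)) (constants-𝟙 i j))
    TM₁T′≈M₂ₚ : ((constants T PMat.⊗ constants M₁) PMat.⊗ constants T′) PMat.≈ᴹ constants M₂
    TM₁T′≈M₂ₚ i j = P.trans (PSums.sumR-cong n (λ t → P.*-congʳ (P.sym (constants-⊗ T M₁ i t))))
                     (P.trans (P.sym (constants-⊗ (T ⊗ M₁) T′ i j)) (constant-cong (TM₁T′≈M₂ i j)))

module QLaplacian {c ℓ : Level} (R : CommutativeRing c ℓ) (q : CommutativeRing.Carrier R) where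
  open CommutativeRing R hiding (zero)
  open Mat R
  open FiniteSums R

  β : Bool → Carrier
  β b = if b then 1# else 0#

  β-∧ : ∀ a b → β (a ∧ b) ≈ β a * β b
  β-∧ true  b = sym (*-identityˡ _)
  β-∧ false b = sym (zeroˡ _)

  β-idem : ∀ a → β a * β a ≈ β a
  β-idem true  = *-identityˡ _
  β-idem false = zeroˡ _

  fromℕ-β : ∀ b → fromℕ (if b then 1 else 0) ≈ β b
  fromℕ-β true  = +-identityʳ _
  fromℕ-β false = refl

  fromℕ-deg : ∀ {m} (G : Graph m) v → fromℕ (deg G v) ≈ sumR m (λ w → β (G v w))
  fromℕ-deg {m} G v = trans (fromℕ-sumℕ m _) (sumR-cong m (λ w → fromℕ-β (G v w)))

  qLap-diag : ∀ {m} (G : Graph m) v → qLap q G v v ≈ q * sumR m (λ w → β (G v w))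
  qLap-diag G v with v Fin.≟ v
  ... | yes _   = *-congˡ (fromℕ-deg G v)
  ... | no v≢v = ⊥-elim (v≢v ≡.refl)

  qLap-offDiag : ∀ {m} (G : Graph m) {u v} → u ≢ v → qLap q G u v ≈ β (G u v)
  qLap-offDiag G {u} {v} u≢v with u Fin.≟ v
  ... | yes u≡v = ⊥-elim (u≢v u≡v)
  ... | no _    = refl

module BlockMatrices {c ℓr : Level} (R : CommutativeRing c ℓr)
                     {n ℓ : ℕ} (part : Fin n → Fin ℓ) (k : Fin ℓ → ℕ) where
  open CommutativeRing R hiding (zero)
  open Mat R
  open FiniteSums R
  open MatrixAlgebra R
  open IntegerCoefficients R using (solve; _:*_; _:=_)
  open SetoidReasoning setoid

  K : Fin n → ℕ
  K = k ∘ part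

  Vertex : Set
  Vertex = Σ (Fin n) (Fin ∘ K)

  VMatrix : Set c
  VMatrix = Vertex → Vertex → Carrier

  infix 4 _≈ⱽ_
  _≈ⱽ_ : VMatrix → VMatrix → Set ℓr
  W ≈ⱽ Z = ∀ x y → W x y ≈ Z x y

  _⊕_ : VMatrix → VMatrix → VMatrix
  (W ⊕ Z) x y = W x y + Z x y

  _⊙_ : VMatrix → VMatrix → VMatrix
  (W ⊙ Z) x y = sumR n (λ w → sumR (K w) (λ c → W x (w , c) * Z (w , c) y))

  lift : VMatrix → Matrix (total n K)
  lift W i j = W (decode n K i) (decode n K j)

  lift-cong : ∀ {W Z} → W ≈ⱽ Z → lift W ≈ᴹ lift Z
  lift-cong W≈Z i j = W≈Z (decode n K i) (decode n K j)

  lift-⊙ : ∀ W Z → (lift W ⊗ lift Z) ≈ᴹ lift (W ⊙ Z)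
  lift-⊙ W Z i j = sumR-decode n K (λ x → W (decode n K i) x * Z x (decode n K j))

  ⊙-congˡ : ∀ {W W′} Z → W ≈ⱽ W′ → (W ⊙ Z) ≈ⱽ (W′ ⊙ Z)
  ⊙-congˡ Z W≈W′ x y = sumR-cong n (λ w → sumR-cong (K w) (λ c → *-congʳ (W≈W′ x (w , c))))

  ⊙-distribˡ : ∀ W Z Z′ → (W ⊙ (Z ⊕ Z′)) ≈ⱽ ((W ⊙ Z) ⊕ (W ⊙ Z′))
  ⊙-distribˡ W Z Z′ x y = begin
    sumR n (λ w → sumR (K w) (λ c → W x (w , c) * (Z (w , c) y + Z′ (w , c) y)))
      ≈⟨ sumR-cong n (λ w → trans (sumR-cong (K w) (λ c → distribˡ _ _ _)) (sumR-+ (K w) _ _)) ⟩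
    sumR n (λ w → sumR (K w) (λ c → W x (w , c) * Z (w , c) y) + sumR (K w) (λ c → W x (w , c) * Z′ (w , c) y))
      ≈⟨ sumR-+ n _ _ ⟩
    (W ⊙ Z) x y + (W ⊙ Z′) x y ∎

  ⊙-distribʳ : ∀ W W′ Z → ((W ⊕ W′) ⊙ Z) ≈ⱽ ((W ⊙ Z) ⊕ (W′ ⊙ Z))
  ⊙-distribʳ W W′ Z x y = begin
    sumR n (λ w → sumR (K w) (λ c → (W x (w , c) + W′ x (w , c)) * Z (w , c) y))
      ≈⟨ sumR-cong n (λ w → trans (sumR-cong (K w) (λ c → distribʳ _ _ _)) (sumR-+ (K w) _ _)) ⟩
    sumR n (λ w → sumR (K w) (λ c → W x (w , c) * Z (w , c) y) + sumR (K w) (λ c → W′ x (w , c) * Z (w , c) y))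
      ≈⟨ sumR-+ n _ _ ⟩
    (W ⊙ Z) x y + (W′ ⊙ Z) x y ∎

  conjugate-⊕ : ∀ W Z Z′ W′ → ((W ⊙ (Z ⊕ Z′)) ⊙ W′) ≈ⱽ (((W ⊙ Z) ⊙ W′) ⊕ ((W ⊙ Z′) ⊙ W′))
  conjugate-⊕ W Z Z′ W′ x y = trans (⊙-congˡ W′ (⊙-distribˡ W Z Z′) x y) (⊙-distribʳ (W ⊙ Z) (W ⊙ Z′) W′ x y)

  δ : ℕ → ℕ → Carrier
  δ x y = if ⌊ x ℕ.≟ y ⌋ then 1# else 0#

  δ-diag : ∀ x → δ x x ≈ 1#
  δ-diag x with x ℕ.≟ x
  ... | yes _   = refl
  ... | no x≢x = ⊥-elim (x≢x ≡.refl)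

  δ-offDiag : ∀ {x y} → x ≢ y → δ x y ≈ 0#
  δ-offDiag {x} {y} x≢y with x ℕ.≟ y
  ... | yes x≡y = ⊥-elim (x≢y x≡y)
  ... | no _    = refl

  δ-sym : ∀ x y → δ x y ≈ δ y x
  δ-sym x y with x ℕ.≟ y | y ℕ.≟ x
  ... | yes _   | yes _   = refl
  ... | no _    | no _    = refl
  ... | yes x≡y | no y≢x  = ⊥-elim (y≢x (≡.sym x≡y))
  ... | no x≢y  | yes y≡x = ⊥-elim (x≢y (≡.sym y≡x))

  sumR-δ : ∀ m x (φ : ℕ → Carrier) → x ℕ.< m → sumR m (λ c → δ x (toℕ c) * φ (toℕ c)) ≈ φ x
  sumR-δ m x φ x<m = begin
    sumR m (λ c → δ x (toℕ c) * φ (toℕ c))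
      ≈⟨ sumR-single m _ x′ (λ c c≢x′ → trans (*-congʳ (δ-offDiag (x≢ c c≢x′))) (zeroˡ _)) ⟩
    δ x (toℕ x′) * φ (toℕ x′)                ≡⟨ ≡.cong (λ t → δ x t * φ t) (Fin.toℕ-fromℕ< x<m) ⟩
    δ x x * φ x                              ≈⟨ trans (*-congʳ (δ-diag x)) (*-identityˡ _) ⟩
    φ x                                      ∎
    where
    x′ : Fin m
    x′ = Fin.fromℕ< x<m
    x≢ : ∀ c → c ≢ x′ → x ≢ toℕ c
    x≢ c c≢x′ x≡c = c≢x′ (Fin.toℕ-injective (≡.trans (≡.sym x≡c) (≡.sym (Fin.toℕ-fromℕ< x<m))))

  -- Entries inside the block of (part u, part v) are indexed by toℕ, so that a block between copies
  -- of different sizes can still be written down.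
  BlockEntries : Set c
  BlockEntries = Fin ℓ → Fin ℓ → ℕ → ℕ → Carrier

  _⊠_ : Matrix n → BlockEntries → VMatrix
  (A ⊠ h) (u , a) (v , b) = A u v * h (part u) (part v) (toℕ a) (toℕ b)

  identityEntries : BlockEntries
  identityEntries _ _ = δ

  ⊠-cong : ∀ {A B} h → A ≈ᴹ B → (A ⊠ h) ≈ⱽ (B ⊠ h)
  ⊠-cong h A≈B (u , a) (v , b) = *-congʳ (A≈B u v)

  lift-𝟙⊠identity : lift (𝟙 ⊠ identityEntries) ≈ᴹ 𝟙
  lift-𝟙⊠identity i j with i Fin.≟ j
  ... | yes ≡.refl = trans (*-cong (𝟙-diag _) (δ-diag _)) (*-identityˡ _)
  ... | no i≢j     = entry-off (decode n K i) (decode n K j) (i≢j ∘ decode-injective n K)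
    where
    entry-off : ∀ x y → x ≢ y → (𝟙 ⊠ identityEntries) x y ≈ 0#
    entry-off (u , a) (v , b) x≢y with u Fin.≟ v
    ... | no _       = zeroˡ _
    ... | yes ≡.refl = trans (*-congˡ (δ-offDiag (x≢y ∘ ≡.cong (u ,_) ∘ Fin.toℕ-injective))) (zeroʳ _)

  annihilated : ∀ {a} x y → a ≈ 0# → a * x ≈ a * y
  annihilated x y a≈0 = trans (*-congʳ a≈0) (trans (zeroˡ x) (sym (trans (*-congʳ a≈0) (zeroˡ y))))

  module _ {Q : Matrix n} (Q-block : BlockDiagonal part Q) where
    blockDiagonal-part : ∀ u w (φ : Fin ℓ → Carrier) → Q u w * φ (part w) ≈ Q u w * φ (part u)
    blockDiagonal-part u w φ with part u Fin.≟ part w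
    ... | yes pu≡pw = *-congˡ (reflexive (≡.cong φ (≡.sym pu≡pw)))
    ... | no pu≢pw  = annihilated _ _ (Q-block u w pu≢pw)

    blockDiagonal-δ : ∀ u w (a : Fin (K u)) (φ : ℕ → Carrier) →
                      Q u w * sumR (K w) (λ c → δ (toℕ a) (toℕ c) * φ (toℕ c)) ≈ Q u w * φ (toℕ a)
    blockDiagonal-δ u w a φ with part u Fin.≟ part w
    ... | yes pu≡pw = *-congˡ (sumR-δ (K w) (toℕ a) φ (≡.subst (λ i → toℕ a ℕ.< k i) pu≡pw (Fin.toℕ<n a)))
    ... | no pu≢pw  = annihilated _ _ (Q-block u w pu≢pw)

  blockDiagonal-transpose : ∀ {Q} → BlockDiagonal part Q → BlockDiagonal part (λ u v → Q v u)
  blockDiagonal-transpose Q-block u v pu≢pv = Q-block v u (pu≢pv ∘ ≡.sym)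

  -- S′ u v = (S′ D S S′) u v = (S′ S D S′) u v = (D S′) u v, where D, the diagonal indicator of the block
  -- of v, commutes with S because S is block diagonal.
  blockDiagonal-inverse : ∀ {S S′} → BlockDiagonal part S → (S ⊗ S′) ≈ᴹ 𝟙 → (S′ ⊗ S) ≈ᴹ 𝟙 →
                          BlockDiagonal part S′
  blockDiagonal-inverse {S} {S′} S-block SS′≈𝟙 S′S≈𝟙 u v pu≢pv = begin
    S′ u v                                                 ≈⟨ trans (*-congˡ inBlock-self) (*-identityʳ _) ⟨
    S′ u v * inBlock v                                     ≈⟨ sumR-𝟙ʳ v (λ t → S′ u t * inBlock t) ⟨
    sumR n (λ t → (S′ u t * inBlock t) * 𝟙 t v)           ≈⟨ sumR-cong n (λ t → *-congˡ (sym (SS′≈𝟙 t v))) ⟩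
    sumR n (λ t → (S′ u t * inBlock t) * sumR n (λ s → S t s * S′ s v))
      ≈⟨ sumR-cong n (λ t → trans (*-distribˡ-sumR n _ _) (sumR-cong n (move t))) ⟩
    sumR n (λ t → sumR n (λ s → (S′ u t * S t s) * (inBlock s * S′ s v)))
      ≈⟨ sumR-comm n n _ ⟩
    sumR n (λ s → sumR n (λ t → (S′ u t * S t s) * (inBlock s * S′ s v)))
      ≈⟨ sumR-cong n (λ s → trans (sym (*-distribʳ-sumR n _ _)) (*-congʳ (S′S≈𝟙 u s))) ⟩
    sumR n (λ s → 𝟙 u s * (inBlock s * S′ s v))           ≈⟨ sumR-𝟙ˡ u _ ⟩
    inBlock u * S′ u v                                     ≈⟨ annihilated _ _ inBlock-other ⟩
    inBlock u * 0#                                         ≈⟨ zeroʳ _ ⟩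
    0#                                                     ∎
    where
    inBlockOf : Fin ℓ → Carrier
    inBlockOf i = if ⌊ i Fin.≟ part v ⌋ then 1# else 0#
    inBlock : Fin n → Carrier
    inBlock t = inBlockOf (part t)
    inBlock-self : inBlock v ≈ 1#
    inBlock-self with part v Fin.≟ part v
    ... | yes _     = refl
    ... | no pv≢pv  = ⊥-elim (pv≢pv ≡.refl)
    inBlock-other : inBlock u ≈ 0#
    inBlock-other with part u Fin.≟ part v
    ... | yes pu≡pv = ⊥-elim (pu≢pv pu≡pv)
    ... | no _      = refl
    move : ∀ t s → (S′ u t * inBlock t) * (S t s * S′ s v) ≈ (S′ u t * S t s) * (inBlock s * S′ s v)
    move t s = begin
      (S′ u t * inBlock t) * (S t s * S′ s v)
        ≈⟨ solve 4 (λ a d b e → (a :* d) :* (b :* e) := a :* ((b :* d) :* e)) refl (S′ u t) (inBlock t) (S t s) (S′ s v) ⟩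
      S′ u t * ((S t s * inBlock t) * S′ s v)
        ≈⟨ *-congˡ (*-congʳ (blockDiagonal-part S-block t s inBlockOf)) ⟨
      S′ u t * ((S t s * inBlock s) * S′ s v)
        ≈⟨ solve 4 (λ a d b e → a :* ((b :* d) :* e) := (a :* b) :* (d :* e)) refl (S′ u t) (inBlock s) (S t s) (S′ s v) ⟩
      (S′ u t * S t s) * (inBlock s * S′ s v)
        ∎

  ⊠-⊙ˡ : ∀ {S} → BlockDiagonal part S → ∀ A h → ((S ⊠ identityEntries) ⊙ (A ⊠ h)) ≈ⱽ ((S ⊗ A) ⊠ h)
  ⊠-⊙ˡ {S} S-block A h (u , a) (v , b) = begin
    sumR n (λ w → sumR (K w) (λ c → (S u w * δ (toℕ a) (toℕ c)) * (A w v * h (part w) (part v) (toℕ c) (toℕ b))))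
      ≈⟨ sumR-cong n (λ w → trans (sumR-cong (K w) (λ c → *-assoc _ _ _)) (sym (*-distribˡ-sumR (K w) (S u w) _))) ⟩
    sumR n (λ w → S u w * sumR (K w) (λ c → δ (toℕ a) (toℕ c) * (A w v * h (part w) (part v) (toℕ c) (toℕ b))))
      ≈⟨ sumR-cong n (λ w → blockDiagonal-δ S-block u w a (λ x → A w v * h (part w) (part v) x (toℕ b))) ⟩
    sumR n (λ w → S u w * (A w v * h (part w) (part v) (toℕ a) (toℕ b)))
      ≈⟨ sumR-cong n (λ w → trans (blockDiagonal-part S-block u w (λ i → A w v * h i (part v) (toℕ a) (toℕ b)))
                                   (sym (*-assoc _ _ _))) ⟩
    sumR n (λ w → (S u w * A w v) * h (part u) (part v) (toℕ a) (toℕ b))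
      ≈⟨ *-distribʳ-sumR n _ _ ⟨
    (S ⊗ A) u v * h (part u) (part v) (toℕ a) (toℕ b) ∎

  ⊠-⊙ʳ : ∀ {S} → BlockDiagonal part S → ∀ A h → ((A ⊠ h) ⊙ (S ⊠ identityEntries)) ≈ⱽ ((A ⊗ S) ⊠ h)
  ⊠-⊙ʳ {S} S-block A h (u , a) (v , b) = begin
    sumR n (λ w → sumR (K w) (λ c → (A u w * h (part u) (part w) (toℕ a) (toℕ c)) * (S w v * δ (toℕ c) (toℕ b))))
      ≈⟨ sumR-cong n (λ w → trans (sumR-cong (K w) (λ c → rearrange (A u w) _ (S w v) (δ-sym (toℕ c) (toℕ b))))
                                   (sym (*-distribˡ-sumR (K w) (S w v) _))) ⟩
    sumR n (λ w → S w v * sumR (K w) (λ c → δ (toℕ b) (toℕ c) * (A u w * h (part u) (part w) (toℕ a) (toℕ c))))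
      ≈⟨ sumR-cong n (λ w → blockDiagonal-δ Sᵀ-block v w b (λ x → A u w * h (part u) (part w) (toℕ a) x)) ⟩
    sumR n (λ w → S w v * (A u w * h (part u) (part w) (toℕ a) (toℕ b)))
      ≈⟨ sumR-cong n (λ w → trans (blockDiagonal-part Sᵀ-block v w (λ i → A u w * h (part u) i (toℕ a) (toℕ b)))
                                   (solve 3 (λ s x y → s :* (x :* y) := (x :* s) :* y) refl (S w v) (A u w) _)) ⟩
    sumR n (λ w → (A u w * S w v) * h (part u) (part v) (toℕ a) (toℕ b))
      ≈⟨ *-distribʳ-sumR n _ _ ⟨
    (A ⊗ S) u v * h (part u) (part v) (toℕ a) (toℕ b) ∎
    where
    Sᵀ-block : BlockDiagonal part (λ u v → S v u)
    Sᵀ-block = blockDiagonal-transpose S-block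
    rearrange : ∀ x y s {d d′} → d ≈ d′ → (x * y) * (s * d) ≈ s * (d′ * (x * y))
    rearrange x y s {d} d≈d′ =
      trans (solve 4 (λ x y s d → (x :* y) :* (s :* d) := s :* (d :* (x :* y))) refl x y s d) (*-congˡ (*-congʳ d≈d′))

  conjugate-⊠ : ∀ {S S′} → BlockDiagonal part S → BlockDiagonal part S′ → ∀ A h →
                (((S ⊠ identityEntries) ⊙ (A ⊠ h)) ⊙ (S′ ⊠ identityEntries)) ≈ⱽ (((S ⊗ A) ⊗ S′) ⊠ h)
  conjugate-⊠ {S} {S′} S-block S′-block A h x y =
    trans (⊙-congˡ (S′ ⊠ identityEntries) (⊠-⊙ˡ S-block A h) x y) (⊠-⊙ʳ S′-block (S ⊗ A) h x y)

  lift-⊠-inverse : ∀ {S S′} → BlockDiagonal part S → (S ⊗ S′) ≈ᴹ 𝟙 →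
                   (lift (S ⊠ identityEntries) ⊗ lift (S′ ⊠ identityEntries)) ≈ᴹ 𝟙
  lift-⊠-inverse {S} {S′} S-block SS′≈𝟙 =
    ≈ᴹ-trans (lift-⊙ (S ⊠ identityEntries) (S′ ⊠ identityEntries)) (≈ᴹ-trans (lift-cong product≈𝟙) lift-𝟙⊠identity)
    where
    product≈𝟙 : ((S ⊠ identityEntries) ⊙ (S′ ⊠ identityEntries)) ≈ⱽ (𝟙 ⊠ identityEntries)
    product≈𝟙 x y = trans (⊠-⊙ˡ S-block S′ identityEntries x y) (⊠-cong identityEntries SS′≈𝟙 x y)

module RootedProductLaplacian {c ℓr : Level} (R : CommutativeRing c ℓr) (q : CommutativeRing.Carrier R)
         {n ℓ : ℕ} (part : Fin n → Fin ℓ) (k : Fin ℓ → ℕ)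
         (H : (i : Fin ℓ) → Graph (k i)) (root : (i : Fin ℓ) → Fin (k i)) where
  open CommutativeRing R hiding (zero)
  open Mat R
  open FiniteSums R
  open MatrixAlgebra R
  open QLaplacian R q
  open BlockMatrices R part k
  open IntegerCoefficients R using (solve; _:+_; _:*_; _:=_)
  open SetoidReasoning setoid

  copyEntries : BlockEntries
  copyEntries i _ = atℕ (k i) (qLap q (H i))

  isRootℕ : Fin ℓ → ℕ → Carrier
  isRootℕ i x = δ x (toℕ (root i))

  rootEntries : BlockEntries
  rootEntries i j x y = isRootℕ i x * isRootℕ j y

  splitLaplacian : Graph n → VMatrix
  splitLaplacian G = (𝟙 ⊠ copyEntries) ⊕ (qLap q G ⊠ rootEntries)

  module _ (G : Graph n) (G-loopless : ∀ v → G v v ≡ false) where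
    open Rooted G part k H root using (adjΣ; sameCopy; isRoot)

    sameCopy-same : ∀ u a b → sameCopy u a u b ≡ H (part u) a b
    sameCopy-same u a b with u Fin.≟ u
    ... | yes ≡.refl = ≡.refl
    ... | no u≢u     = ⊥-elim (u≢u ≡.refl)

    sameCopy-diff : ∀ {u v} a b → u ≢ v → sameCopy u a v b ≡ false
    sameCopy-diff {u} {v} a b u≢v with u Fin.≟ v
    ... | yes u≡v = ⊥-elim (u≢v u≡v)
    ... | no _    = ≡.refl

    adjΣ-same : ∀ u a b → adjΣ (u , a) (u , b) ≡ H (part u) a b
    adjΣ-same u a b
      rewrite sameCopy-same u a b | G-loopless u | Bool.∧-zeroʳ (isRoot u b) | Bool.∧-zeroʳ (isRoot u a) =
      Bool.∨-identityʳ _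

    adjΣ-diff : ∀ {u v} a b → u ≢ v → adjΣ (u , a) (v , b) ≡ isRoot u a ∧ (isRoot v b ∧ G u v)
    adjΣ-diff a b u≢v rewrite sameCopy-diff a b u≢v = ≡.refl

    β-isRoot-root : ∀ u → β (isRoot u (root (part u))) ≈ 1#
    β-isRoot-root u with root (part u) Fin.≟ root (part u)
    ... | yes _   = refl
    ... | no r≢r = ⊥-elim (r≢r ≡.refl)

    β-isRoot-other : ∀ u {a} → a ≢ root (part u) → β (isRoot u a) ≈ 0#
    β-isRoot-other u {a} a≢r with a Fin.≟ root (part u)
    ... | yes a≡r = ⊥-elim (a≢r a≡r)
    ... | no _    = refl

    β-isRoot : ∀ u a → β (isRoot u a) ≈ isRootℕ (part u) (toℕ a)
    β-isRoot u a with a Fin.≟ root (part u)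
    ... | yes ≡.refl = sym (δ-diag _)
    ... | no a≢r     = sym (δ-offDiag (a≢r ∘ Fin.toℕ-injective))

    degreeH : ∀ u → Fin (K u) → Carrier
    degreeH u a = sumR (K u) (λ c → β (H (part u) a c))

    degreeG : Fin n → Carrier
    degreeG u = sumR n (λ w → β (G u w))

    adjacency-block : ∀ u a w →
      sumR (K w) (λ c → β (adjΣ (u , a) (w , c))) ≈ 𝟙 u w * degreeH u a + β (isRoot u a) * β (G u w)
    adjacency-block u a w = by-cases (u Fin.≟ w)
      where
      by-cases : Dec (u ≡ w) →
        sumR (K w) (λ c → β (adjΣ (u , a) (w , c))) ≈ 𝟙 u w * degreeH u a + β (isRoot u a) * β (G u w)
      by-cases (yes ≡.refl) = begin
        sumR (K u) (λ c → β (adjΣ (u , a) (u , c)))  ≈⟨ sumR-cong (K u) (λ c → reflexive (≡.cong β (adjΣ-same u a c))) ⟩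
        degreeH u a                                   ≈⟨ +-identityʳ _ ⟨
        degreeH u a + 0#
          ≈⟨ +-cong (trans (*-congʳ (𝟙-diag u)) (*-identityˡ _))
                    (trans (*-congˡ (reflexive (≡.cong β (G-loopless u)))) (zeroʳ _)) ⟨
        𝟙 u u * degreeH u a + β (isRoot u a) * β (G u u) ∎
      by-cases (no u≢w) = begin
        sumR (K w) (λ c → β (adjΣ (u , a) (w , c)))
          ≈⟨ sumR-cong (K w) (λ c → trans (reflexive (≡.cong β (adjΣ-diff a c u≢w))) (trans (β-∧ _ _) (*-congˡ (β-∧ _ _)))) ⟩
        sumR (K w) (λ c → β (isRoot u a) * (β (isRoot w c) * β (G u w)))
          ≈⟨ sumR-cong (K w) (λ c → solve 3 (λ x y z → x :* (y :* z) := (x :* z) :* y) refl _ _ _) ⟩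
        sumR (K w) (λ c → (β (isRoot u a) * β (G u w)) * β (isRoot w c))
          ≈⟨ *-distribˡ-sumR (K w) _ _ ⟨
        (β (isRoot u a) * β (G u w)) * sumR (K w) (λ c → β (isRoot w c))
          ≈⟨ trans (*-congˡ root-count) (*-identityʳ _) ⟩
        β (isRoot u a) * β (G u w)
          ≈⟨ +-identityˡ _ ⟨
        0# + β (isRoot u a) * β (G u w)
          ≈⟨ +-congʳ (trans (*-congʳ (𝟙-offDiag u≢w)) (zeroˡ _)) ⟨
        𝟙 u w * degreeH u a + β (isRoot u a) * β (G u w) ∎
        where
        root-count : sumR (K w) (λ c → β (isRoot w c)) ≈ 1#
        root-count = trans (sumR-single (K w) _ (root (part w)) (λ c → β-isRoot-other w)) (β-isRoot-root w)

    degreeΣ : Vertex → Carrier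
    degreeΣ (u , a) = degreeH u a + β (isRoot u a) * degreeG u

    degree : ∀ x → sumR n (λ w → sumR (K w) (λ c → β (adjΣ x (w , c)))) ≈ degreeΣ x
    degree (u , a) = begin
      sumR n (λ w → sumR (K w) (λ c → β (adjΣ (u , a) (w , c))))
        ≈⟨ sumR-cong n (adjacency-block u a) ⟩
      sumR n (λ w → 𝟙 u w * degreeH u a + β (isRoot u a) * β (G u w))
        ≈⟨ sumR-+ n _ _ ⟩
      sumR n (λ w → 𝟙 u w * degreeH u a) + sumR n (λ w → β (isRoot u a) * β (G u w))
        ≈⟨ +-cong (sumR-𝟙ˡ u (λ _ → degreeH u a)) (sym (*-distribˡ-sumR n _ _)) ⟩
      degreeH u a + β (isRoot u a) * degreeG u ∎

    product-degree : ∀ i → fromℕ (deg (rootedProduct G part k H root) i) ≈ degreeΣ (decode n K i)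
    product-degree i = begin
      fromℕ (deg (rootedProduct G part k H root) i)                     ≈⟨ fromℕ-deg (rootedProduct G part k H root) i ⟩
      sumR (total n K) (λ j → β (adjΣ (decode n K i) (decode n K j)))   ≈⟨ sumR-decode n K (β ∘ adjΣ (decode n K i)) ⟩
      sumR n (λ w → sumR (K w) (λ c → β (adjΣ (decode n K i) (w , c)))) ≈⟨ degree (decode n K i) ⟩
      degreeΣ (decode n K i)                                            ∎

    entry-diag : ∀ x → q * degreeΣ x ≈ splitLaplacian G x x
    entry-diag (u , a) = begin
      q * (degreeH u a + r * degreeG u)
        ≈⟨ solve 4 (λ q h r g → q :* (h :+ r :* g) := q :* h :+ (q :* g) :* r) refl q (degreeH u a) r (degreeG u) ⟩
      q * degreeH u a + (q * degreeG u) * r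
        ≈⟨ +-cong (sym (trans (*-congʳ (𝟙-diag u)) (trans (*-identityˡ _) copy-entry)))
                  (*-cong (sym (qLap-diag G u)) (trans (sym (β-idem _)) (*-cong (β-isRoot u a) (β-isRoot u a)))) ⟩
      𝟙 u u * atℕ (K u) (qLap q (H (part u))) (toℕ a) (toℕ a)
        + qLap q G u u * (isRootℕ (part u) (toℕ a) * isRootℕ (part u) (toℕ a)) ∎
      where
      r : Carrier
      r = β (isRoot u a)
      copy-entry : atℕ (K u) (qLap q (H (part u))) (toℕ a) (toℕ a) ≈ q * degreeH u a
      copy-entry = trans (atℕ-toℕ _ _ a a) (qLap-diag (H (part u)) a)

    roots-distinct : ∀ u {a b : Fin (K u)} → a ≢ b → isRootℕ (part u) (toℕ a) * isRootℕ (part u) (toℕ b) ≈ 0#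
    roots-distinct u {a} {b} a≢b with a Fin.≟ root (part u)
    ... | yes ≡.refl = trans (*-congˡ (δ-offDiag (a≢b ∘ ≡.sym ∘ Fin.toℕ-injective))) (zeroʳ _)
    ... | no a≢r     = trans (*-congʳ (δ-offDiag (a≢r ∘ Fin.toℕ-injective))) (zeroˡ _)

    entry-offDiag : ∀ x y → x ≢ y → β (adjΣ x y) ≈ splitLaplacian G x y
    entry-offDiag (u , a) (v , b) x≢y = by-cases (u Fin.≟ v)
      where
      by-cases : Dec (u ≡ v) → β (adjΣ (u , a) (v , b)) ≈ splitLaplacian G (u , a) (v , b)
      by-cases (yes ≡.refl) = begin
        β (adjΣ (u , a) (u , b))                          ≡⟨ ≡.cong β (adjΣ-same u a b) ⟩
        β (H (part u) a b)                                ≈⟨ qLap-offDiag (H (part u)) a≢b ⟨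
        qLap q (H (part u)) a b                           ≈⟨ atℕ-toℕ _ _ a b ⟨
        atℕ (K u) (qLap q (H (part u))) (toℕ a) (toℕ b)    ≈⟨ trans (+-cong copy-part root-part) (+-identityʳ _) ⟨
        splitLaplacian G (u , a) (u , b)                   ∎
        where
        a≢b : a ≢ b
        a≢b a≡b = x≢y (≡.cong (u ,_) a≡b)
        copy-part : ∀ {e} → 𝟙 u u * e ≈ e
        copy-part = trans (*-congʳ (𝟙-diag u)) (*-identityˡ _)
        root-part : qLap q G u u * (isRootℕ (part u) (toℕ a) * isRootℕ (part u) (toℕ b)) ≈ 0#
        root-part = trans (*-congˡ (roots-distinct u a≢b)) (zeroʳ _)
      by-cases (no u≢v) = begin
        β (adjΣ (u , a) (v , b))                        ≡⟨ ≡.cong β (adjΣ-diff a b u≢v) ⟩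
        β (isRoot u a ∧ (isRoot v b ∧ G u v))           ≈⟨ trans (β-∧ _ _) (*-congˡ (β-∧ _ _)) ⟩
        β (isRoot u a) * (β (isRoot v b) * β (G u v))
          ≈⟨ *-cong (β-isRoot u a) (*-cong (β-isRoot v b) (sym (qLap-offDiag G u≢v))) ⟩
        ρa * (ρb * qLap q G u v)
          ≈⟨ solve 3 (λ x y z → x :* (y :* z) := z :* (x :* y)) refl ρa ρb (qLap q G u v) ⟩
        qLap q G u v * (ρa * ρb)                        ≈⟨ +-identityˡ _ ⟨
        0# + qLap q G u v * (ρa * ρb)                   ≈⟨ +-congʳ (trans (*-congʳ (𝟙-offDiag u≢v)) (zeroˡ _)) ⟨
        splitLaplacian G (u , a) (v , b)                 ∎
        where
        ρa ρb : Carrier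
        ρa = isRootℕ (part u) (toℕ a)
        ρb = isRootℕ (part v) (toℕ b)

    laplacian-decomposition : qLap q (rootedProduct G part k H root) ≈ᴹ lift (splitLaplacian G)
    laplacian-decomposition i j with i Fin.≟ j
    ... | yes ≡.refl = trans (*-congˡ (product-degree i)) (entry-diag (decode n K i))
    ... | no i≢j     = entry-offDiag _ _ (i≢j ∘ decode-injective n K)

  rootedProduct-similar : ∀ {G₁ G₂ : Graph n} {S S′ : Matrix n} →
    (∀ v → G₁ v v ≡ false) → (∀ v → G₂ v v ≡ false) → BlockDiagonal part S → BlockDiagonal part S′ →
    (S ⊗ S′) ≈ᴹ 𝟙 → ((S ⊗ qLap q G₁) ⊗ S′) ≈ᴹ qLap q G₂ →
    ((lift (S ⊠ identityEntries) ⊗ qLap q (rootedProduct G₁ part k H root)) ⊗ lift (S′ ⊠ identityEntries))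
      ≈ᴹ qLap q (rootedProduct G₂ part k H root)
  rootedProduct-similar {G₁} {G₂} {S} {S′} G₁-loopless G₂-loopless S-block S′-block SS′≈𝟙 S-similar =
    ≈ᴹ-trans (⊗-cong (≈ᴹ-trans (⊗-cong ≈ᴹ-refl (laplacian-decomposition G₁ G₁-loopless))
                               (lift-⊙ T (splitLaplacian G₁)))
                     ≈ᴹ-refl)
   (≈ᴹ-trans (lift-⊙ (T ⊙ splitLaplacian G₁) T′)
   (≈ᴹ-trans (lift-cong conjugated)
             (≈ᴹ-sym (laplacian-decomposition G₂ G₂-loopless))))
    where
    T T′ : VMatrix
    T = S ⊠ identityEntries
    T′ = S′ ⊠ identityEntries
    S𝟙S′≈𝟙 : ((S ⊗ 𝟙) ⊗ S′) ≈ᴹ 𝟙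
    S𝟙S′≈𝟙 = ≈ᴹ-trans (⊗-cong (⊗-identityʳ S) ≈ᴹ-refl) SS′≈𝟙
    conjugated : ((T ⊙ splitLaplacian G₁) ⊙ T′) ≈ⱽ splitLaplacian G₂
    conjugated x y = trans (conjugate-⊕ T (𝟙 ⊠ copyEntries) (qLap q G₁ ⊠ rootEntries) T′ x y)
      (+-cong (trans (conjugate-⊠ S-block S′-block 𝟙 copyEntries x y) (⊠-cong copyEntries S𝟙S′≈𝟙 x y))
              (trans (conjugate-⊠ S-block S′-block (qLap q G₁) rootEntries x y) (⊠-cong rootEntries S-similar x y)))

theorem3p2 : ∀ {c ℓr : Level} (R : CommutativeRing c ℓr) →
    let open CommutativeRing R using (Carrier) in
    let open Mat R in
    (q : Carrier) (n ℓ : ℕ) (G₁ G₂ : Graph n) → IsSimple G₁ → IsSimple G₂ →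
    (part : Fin n → Fin ℓ) (S S⁻¹ : Matrix n) → BlockDiagonal part S →
    (S ⊗ S⁻¹) ≈ᴹ 𝟙 → (S⁻¹ ⊗ S) ≈ᴹ 𝟙 →
    ((S ⊗ qLap q G₁) ⊗ S⁻¹) ≈ᴹ qLap q G₂ →
    (k : Fin ℓ → ℕ) (H : (i : Fin ℓ) → Graph (k i)) (root : (i : Fin ℓ) → Fin (k i)) →
    (∀ i → IsSimple (H i)) →
    Cospectral (qLap q (rootedProduct G₁ part k H root)) (qLap q (rootedProduct G₂ part k H root))
theorem3p2 R q n ℓ G₁ G₂ G₁-simple G₂-simple part S S⁻¹ S-block SS⁻¹≈𝟙 S⁻¹S≈𝟙 S-similar k H root _ =
  cospectral-similar (lift (S ⊠ identityEntries)) (lift (S⁻¹ ⊠ identityEntries)) _ _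
    (lift-⊠-inverse S-block SS⁻¹≈𝟙)
    (rootedProduct-similar (proj₂ G₁-simple) (proj₂ G₂-simple) S-block S⁻¹-block SS⁻¹≈𝟙 S-similar)
  where
  open Mat R using (BlockDiagonal)
  open BlockMatrices R part k
  open RootedProductLaplacian R q part k H root using (rootedProduct-similar)
  open CharacteristicPolynomial R using (cospectral-similar)
  S⁻¹-block : BlockDiagonal part S⁻¹
  S⁻¹-block = blockDiagonal-inverse S-block SS⁻¹≈𝟙 S⁻¹S≈𝟙
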